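{- There is an absolute constant $C$ such that for every graph $G=(V,E)$ with at least one edge, the CNF formula $F(X(G),\tilde X(G))$ has a refutation (a derivation of the empty clause $\bot$) in the proof system SRC-I (resolution plus the global symmetry rule) of length at most $C\cdot |F(X(G),\tilde X(G))|$, where $|F|$ denotes the number of clauses of $F$. This holds for every choice of the twisted edge in $\tilde X(G)$.
   Context: Clauses are sets (disjunctions) of literals over a finite variable set; a CNF formula is a set of clauses; $\bot$ is the empty clause. Resolution rule: from $x\vee A$ and $\overline{x}\vee B$ derive $A\vee B$. A derivation from a formula $F$ is a sequence consisting of the clauses of $F$ followed by clauses $c_1,\dots,c_n$, each obtained by an inference rule from earlier clauses; its length is $n$. A renaming is a bijection $\sigma$ on the set of literals with $\sigma(\overline{\ell})=\overline{\sigma(\ell)}$; it acts on clauses and formulas elementwise. Local symmetry rule: if a subsequence of the derivation derives a clause $C$ using only clauses from a subset $F'\subseteq F$ of the original formula, and $\sigma$ is a renaming with $\sigma(F')\subseteq F$, one may derive $\sigma(C)$ in one step. The global symmetry rule is the special case $F'=F$ (i.e. $\sigma(F)\subseteq F$, applicable to any derived clause). SRC-I = resolution + global symmetry rule; SRC-II = resolution + local symmetry rule. Isomorphism formula: for (vertex-colored) graphs $G_1=(V_1,E_1)$, $G_2=(V_2,E_2)$ with $|V_1|=|V_2|$, with variables $x_{v_1,v_2}$ ($v_i\in V_i$), $F(G_1,G_2)$ is the conjunction of: Type 1 clauses $\bigvee_{v_2\in V_2}x_{v_1,v_2}$ for each $v_1\in V_1$; Type 2 clauses $\overline{x_{v_1,v_2}}\vee\overline{x_{v_1',v_2}}$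 for each $v_2\in V_2$ and distinct $v_1,v_1'\in V_1$; Type 3 clauses $\overline{x_{u_1,u_2}}\vee\overline{x_{v_1,v_2}}$ whenever exactly one of $\{u_1,v_1\}\in E_1$, $\{u_2,v_2\}\in E_2$ holds. For colored graphs, every variable $x_{u,v}$ with $u,v$ of different colors is set to false (and the formula simplified accordingly). CFI gadget: for a finite set $N$, $X_N$ has vertices $a_w,b_w$ ($w\in N$) and $m_S$ for every $S\subseteq N$ with $|S|$ even, and edges $\{m_S,a_w\}$ for $w\in S$ and $\{m_S,b_w\}$ for $w\in N\setminus S$. For a graph $G=(V,E)$, $X(G)$ is obtained by taking, for each $v\in V$, a copy $X^v_{E_G(v)}$ of the gadget with $N=E_G(v)$ the set of edges incident to $v$ (vertices $a^v_e,b^v_e,m^v_S$), and adding, for each edge $e=\{u,v\}\in E$, the edges $\{a^u_e,a^v_e\}$ and $\{b^u_e,b^v_e\}$. Vertices are colored so that $a^v_e,b^v_e$ receive the color $(v,e)$ and each $m^v_S$ receives the color $(v,m)$. $\tilde X(G)$ is obtained from $X(G)$ by choosing one edge $e=\{u,v\}\in E$ and replacing $\{a^u_e,a^v_e\},\{b^u_e,b^v_e\}$ by $\{a^u_e,b^v_e\},\{b^u_e,a^v_e\}$. -}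

module Defs where

open import Level using (Level)
open import Data.Bool using (Bool; true; false; _∧_; _∨_; not; _xor_; if_then_else_)
open import Data.Bool.Properties using () renaming (_≟_ to _≟ᵇ_)
open import Data.Nat using (ℕ; zero; suc; _+_)
open import Data.Fin using (Fin) renaming (_≟_ to _≟ᶠ_)
open import Data.Vec using (Vec; []; _∷_; lookup; tabulate)
import Data.Vec.Properties as VecP
open import Data.List using (List; []; _∷_; _++_; map; concatMap; length; deduplicate; [_])
open import Data.List.Membership.Propositional using (_∈_)
open import Data.List.Relation.Unary.Any using (Any)
open import Data.Product using (Σ; ∃; _×_; _,_)
import Data.Product.Properties as ProdP
open import Data.Sum using (_⊎_)
open import Relation.Nullary using (¬_; Dec; yes; no; does)
open import Relation.Nullary.Decidable using (_×-dec_)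
open import Relation.Binary.Definitions using (DecidableEquality)
open import Relation.Binary.PropositionalEquality using (_≡_; _≢_; refl; cong; cong₂)
import Data.List.Relation.Binary.Subset.DecPropositional as SubDec

data Lit (V : Set) : Set where
  pos : V → Lit V
  neg : V → Lit V

‾ : {V : Set} → Lit V → Lit V
‾ (pos x) = neg x
‾ (neg x) = pos x

-- A clause is a SET of literals, represented by a list; two lists denote the
-- same clause iff they have the same members (_≋_).
Clause : Set → Set
Clause V = List (Lit V)

Formula : Set → Set
Formula V = List (Clause V)

_⊆ᶜ_ : {V : Set} → Clause V → Clause V → Set
C ⊆ᶜ D = ∀ {ℓ} → ℓ ∈ C → ℓ ∈ D

_≋_ : {V : Set} → Clause V → Clause V → Set
C ≋ D = (C ⊆ᶜ D) × (D ⊆ᶜ C)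

⊥ᶜ : {V : Set} → Clause V
⊥ᶜ = []

-- Number of clauses |F| of a formula, i.e. the number of pairwise distinct
-- clauses (as sets of literals) in the list representing F.
module _ {V : Set} (_≟_ : DecidableEquality V) where

  _≟ˡ_ : DecidableEquality (Lit V)
  pos x ≟ˡ pos y with x ≟ y
  ... | yes refl = yes refl
  ... | no ne = no λ { refl → ne refl }
  neg x ≟ˡ neg y with x ≟ y
  ... | yes refl = yes refl
  ... | no ne = no λ { refl → ne refl }
  pos x ≟ˡ neg y = no λ ()
  neg x ≟ˡ pos y = no λ ()

  _≋?_ : (C D : Clause V) → Dec (C ≋ D)
  C ≋? D = (C ⊆? D) ×-dec (D ⊆? C)
    where open SubDec _≟ˡ_ using (_⊆?_)

  ∣_∣ᶠ : Formula V → ℕ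
  ∣ F ∣ᶠ = length (deduplicate _≋?_ F)

record Renaming (V : Set) : Set where
  field
    σ       : Lit V → Lit V
    σ⁻¹     : Lit V → Lit V
    inv-l   : ∀ ℓ → σ⁻¹ (σ ℓ) ≡ ℓ
    inv-r   : ∀ ℓ → σ (σ⁻¹ ℓ) ≡ ℓ
    σ-neg   : ∀ ℓ → σ (‾ ℓ) ≡ ‾ (σ ℓ)

open Renaming public

rename : {V : Set} → Renaming V → Clause V → Clause V
rename ρ C = map (σ ρ) C

MapsInto : {V : Set} → Renaming V → Formula V → Formula V → Set
MapsInto ρ F G = ∀ {C} → C ∈ F → ∃ λ D → D ∈ G × (rename ρ C ≋ D)

IsResolvent : {V : Set} → Clause V → Clause V → Clause V → Set
IsResolvent C₁ C₂ D =
  ∃ λ x → pos x ∈ C₁ × neg x ∈ C₂ ×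
    (∀ ℓ → (ℓ ∈ D → (ℓ ∈ C₁ × ℓ ≢ pos x) ⊎ (ℓ ∈ C₂ × ℓ ≢ neg x))
         × ((ℓ ∈ C₁ × ℓ ≢ pos x) ⊎ (ℓ ∈ C₂ × ℓ ≢ neg x) → ℓ ∈ D))

-- One SRC-I step deriving D from the formula F, where Γ is the list of
-- clauses available so far (the clauses of F followed by earlier derived ones).
data SRC-I-Step {V : Set} (F : Formula V) (Γ : List (Clause V)) (D : Clause V) : Set where
  resolution : ∀ {C₁ C₂} → C₁ ∈ Γ → C₂ ∈ Γ → IsResolvent C₁ C₂ D → SRC-I-Step F Γ D
  global-sym : ∀ {C} (ρ : Renaming V) → MapsInto ρ F F → C ∈ Γ →
               D ≋ rename ρ C → SRC-I-Step F Γ D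

data SRC-I-DerivFrom {V : Set} (F : Formula V) : List (Clause V) → List (Clause V) → Set where
  done : ∀ {Γ} → SRC-I-DerivFrom F Γ []
  step : ∀ {Γ c cs} → SRC-I-Step F Γ c → SRC-I-DerivFrom F (Γ ++ [ c ]) cs →
         SRC-I-DerivFrom F Γ (c ∷ cs)

-- An SRC-I refutation of F: a derivation c₁ … cₙ from F containing ⊥.
-- Its length is length cs = n.
SRC-I-Refutation : {V : Set} → Formula V → List (Clause V) → Set
SRC-I-Refutation F cs = SRC-I-DerivFrom F F cs × (⊥ᶜ ∈ cs)

-- Vertices of Gᵢ are the (duplicate-free) list Vᵢ of elements of A, edges are
-- given by symmetric Boolean relations Eᵢ, colours by col : A → Col.
-- Variables x_{v₁,v₂} are pairs (v₁ , v₂); variables with differently coloured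
-- endpoints are set to false and the formula is simplified (positive
-- occurrences dropped, clauses with negative occurrences dropped).

module _ {A Col : Set} (_≟A_ : DecidableEquality A) (_≟C_ : DecidableEquality Col)
         (col : A → Col) where

  compat : A → A → Bool
  compat u v = does (col u ≟C col v)

  filterᵇ : {B : Set} → (B → Bool) → List B → List B
  filterᵇ p [] = []
  filterᵇ p (x ∷ xs) = if p x then x ∷ filterᵇ p xs else filterᵇ p xs

  type1 : List A → List A → Formula (A × A)
  type1 V₁ V₂ = map (λ v₁ → map (λ v₂ → pos (v₁ , v₂)) (filterᵇ (compat v₁) V₂)) V₁

  type2 : List A → List A → Formula (A × A)
  type2 V₁ V₂ =
    concatMap (λ v₂ → concatMap (λ v₁ → concatMap (λ v₁′ →
      if not (does (v₁ ≟A v₁′)) ∧ compat v₁ v₂ ∧ compat v₁′ v₂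
      then [ neg (v₁ , v₂) ∷ neg (v₁′ , v₂) ∷ [] ] else []) V₁) V₁) V₂

  type3 : List A → List A → (A → A → Bool) → (A → A → Bool) → Formula (A × A)
  type3 V₁ V₂ E₁ E₂ =
    concatMap (λ u₁ → concatMap (λ v₁ → concatMap (λ u₂ → concatMap (λ v₂ →
      if compat u₁ u₂ ∧ compat v₁ v₂ ∧ (E₁ u₁ v₁ xor E₂ u₂ v₂)
      then [ neg (u₁ , u₂) ∷ neg (v₁ , v₂) ∷ [] ] else []) V₂) V₂) V₁) V₁

  IsoFormula : List A → List A → (A → A → Bool) → (A → A → Bool) → Formula (A × A)
  IsoFormula V₁ V₂ E₁ E₂ = type1 V₁ V₂ ++ type2 V₁ V₂ ++ type3 V₁ V₂ E₁ E₂

record SimpleGraph (n : ℕ) : Set where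
  field
    adj    : Fin n → Fin n → Bool
    sym    : ∀ u v → adj u v ≡ adj v u
    irrefl : ∀ v → adj v v ≡ false

open SimpleGraph public

-- An edge e = {v,w} incident to v is identified (from v's side) with the
-- neighbour w; so E_G(v) ≅ neighbours of v, and a subset S ⊆ E_G(v) is a
-- Boolean vector S : Vec Bool n contained in the neighbourhood of v.

data XV (n : ℕ) : Set where
  a : Fin n → Fin n → XV n
  b : Fin n → Fin n → XV n
  m : Fin n → Vec Bool n → XV n

data XCol (n : ℕ) : Set where
  cab : Fin n → Fin n → XCol n
  cm  : Fin n → XCol n

xcol : {n : ℕ} → XV n → XCol n
xcol (a v w) = cab v w
xcol (b v w) = cab v w
xcol (m v S) = cm v

_≟XV_ : {n : ℕ} → DecidableEquality (XV n)
a v w ≟XV a v′ w′ with v ≟ᶠ v′ | w ≟ᶠ w′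
... | yes refl | yes refl = yes refl
... | no ne | _ = no λ { refl → ne refl }
... | _ | no ne = no λ { refl → ne refl }
b v w ≟XV b v′ w′ with v ≟ᶠ v′ | w ≟ᶠ w′
... | yes refl | yes refl = yes refl
... | no ne | _ = no λ { refl → ne refl }
... | _ | no ne = no λ { refl → ne refl }
m v S ≟XV m v′ S′ with v ≟ᶠ v′ | VecP.≡-dec _≟ᵇ_ S S′
... | yes refl | yes refl = yes refl
... | no ne | _ = no λ { refl → ne refl }
... | _ | no ne = no λ { refl → ne refl }
a _ _ ≟XV b _ _ = no λ ()
a _ _ ≟XV m _ _ = no λ ()
b _ _ ≟XV a _ _ = no λ ()
b _ _ ≟XV m _ _ = no λ ()
m _ _ ≟XV a _ _ = no λ ()
m _ _ ≟XV b _ _ = no λ ()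

_≟XC_ : {n : ℕ} → DecidableEquality (XCol n)
cab v w ≟XC cab v′ w′ with v ≟ᶠ v′ | w ≟ᶠ w′
... | yes refl | yes refl = yes refl
... | no ne | _ = no λ { refl → ne refl }
... | _ | no ne = no λ { refl → ne refl }
cm v ≟XC cm v′ with v ≟ᶠ v′
... | yes refl = yes refl
... | no ne = no λ { refl → ne refl }
cab _ _ ≟XC cm _ = no λ ()
cm _ ≟XC cab _ _ = no λ ()

_==_ : {n : ℕ} → Fin n → Fin n → Bool
u == v = does (u ≟ᶠ v)

isEven : ℕ → Bool
isEven zero = true
isEven (suc k) = not (isEven k)

count : {k : ℕ} → Vec Bool k → ℕ
count [] = 0
count (true ∷ S) = suc (count S)
count (false ∷ S) = count S

subsetsOf : {k : ℕ} → Vec Bool k → List (Vec Bool k)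
subsetsOf [] = [] ∷ []
subsetsOf (true ∷ M)  = map (true ∷_) (subsetsOf M) ++ map (false ∷_) (subsetsOf M)
subsetsOf (false ∷ M) = map (false ∷_) (subsetsOf M)

allFinList : (n : ℕ) → List (Fin n)
allFinList n = Data.List.tabulate {n = n} (λ i → i)
  where import Data.List

module CFI {n : ℕ} (G : SimpleGraph n) where

  nbrs : Fin n → Vec Bool n
  nbrs v = tabulate (adj G v)

  gadget : Fin n → List (XV n)
  gadget v =
    concatMap (λ w → if adj G v w then a v w ∷ b v w ∷ [] else []) (allFinList n)
    ++ concatMap (λ S → if isEven (count S) then [ m v S ] else []) (subsetsOf (nbrs v))

  -- vertex list of X(G) (= vertex list of X̃(G))
  vertices : List (XV n)
  vertices = concatMap gadget (allFinList n)

  -- edge relation of X(G) with the edges e = {u,w} for which tw u w = true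
  -- twisted; tw is assumed symmetric.
  edgeTw : (Fin n → Fin n → Bool) → XV n → XV n → Bool
  edgeTw tw (m v S) (a v′ w) = (v == v′) ∧ adj G v w ∧ lookup S w
  edgeTw tw (a v′ w) (m v S) = (v == v′) ∧ adj G v w ∧ lookup S w
  edgeTw tw (m v S) (b v′ w) = (v == v′) ∧ adj G v w ∧ not (lookup S w)
  edgeTw tw (b v′ w) (m v S) = (v == v′) ∧ adj G v w ∧ not (lookup S w)
  edgeTw tw (a u w) (a w′ u′) = adj G u w ∧ (w == w′) ∧ (u == u′) ∧ not (tw u w)
  edgeTw tw (b u w) (b w′ u′) = adj G u w ∧ (w == w′) ∧ (u == u′) ∧ not (tw u w)
  edgeTw tw (a u w) (b w′ u′) = adj G u w ∧ (w == w′) ∧ (u == u′) ∧ tw u w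
  edgeTw tw (b u w) (a w′ u′) = adj G u w ∧ (w == w′) ∧ (u == u′) ∧ tw u w
  edgeTw tw (m _ _) (m _ _) = false

  edgeX : XV n → XV n → Bool
  edgeX = edgeTw (λ _ _ → false)

  edgeX̃ : Fin n → Fin n → XV n → XV n → Bool
  edgeX̃ u₀ v₀ = edgeTw (λ u w → ((u == u₀) ∧ (w == v₀)) ∨ ((u == v₀) ∧ (w == u₀)))

  F-CFI : Fin n → Fin n → Formula (XV n × XV n)
  F-CFI u₀ v₀ = IsoFormula _≟XV_ _≟XC_ xcol vertices vertices edgeX (edgeX̃ u₀ v₀)

  size : Fin n → Fin n → ℕ
  size u₀ v₀ = ∣_∣ᶠ (ProdP.≡-dec _≟XV_ _≟XV_) (F-CFI u₀ v₀)

module Submission where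

-- Fix a breadth-first spanning tree of the component of the twisted edge {u₀ , v₀}, rooted at u₀.
-- Climbing the tree layer by layer, resolution inside the gadget of a vertex c turns the facts
-- x_{a^c_w , a^c_w} for all neighbours w other than the parent p into ¬x_{a^c_p , b^c_p}, hence into
-- x_{a^c_p , a^c_p}, which the connecting edge passes on as x_{a^p_c , a^p_c}. For a non-tree edge
-- {x , y} with x < y the literal ¬x_{a^x_y , a^x_y} is simply carried along as an assumption. At the
-- root the twist makes the collected facts contradictory, leaving a clause of assumptions only. Each
-- assumption is then resolved away using the global symmetry that flips the CFI graph along the
-- fundamental cycle of its edge, which fixes every other assumption. The work in a gadget is
-- linear in its number of vertices, and F has a distinct type-1 clause for every vertex of X(G),
-- so the refutation has length at most 10 |F|.

open import Defs hiding (sym)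

open import Data.Bool using (Bool; true; false; _∧_; _∨_; not; _xor_; if_then_else_; T)
open import Data.Bool.Properties using (∨-zeroʳ; ∧-comm; xor-same; xor-assoc; xor-comm; xor-identityʳ; not-distribˡ-xor; not-distribʳ-xor; xor-annihilates-not) renaming (_≟_ to _≟ᵇ_)
open import Data.Empty using (⊥; ⊥-elim)
open import Data.Fin using (Fin; zero; suc; toℕ) renaming (_≟_ to _≟ᶠ_)
open import Data.Fin.Properties using (any?; <-cmp; suc-injective)
open import Data.List using (List; []; _∷_; _++_; length; map; concatMap; filter; deduplicate)
open import Data.List.Membership.Propositional using (_∈_; find; lose)
open import Data.List.Membership.Propositional.Properties using (∈-++⁺ˡ; ∈-++⁺ʳ; ∈-++⁻; ∈-map⁺; ∈-map⁻; ∈-concatMap⁺; ∈-concatMap⁻; ∈-allFin; ∈-filter⁺; ∈-filter⁻)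
import Data.List.Membership.Setoid.Properties as SetoidMembership
open import Data.List.Properties using (++-identityʳ; ++-assoc; length-++; length-map; map-++)
open import Data.List.Relation.Binary.Subset.Propositional using (_⊆_)
import Data.List.Relation.Unary.All as All
open import Data.List.Relation.Unary.AllPairs using (AllPairs; []; _∷_)
import Data.List.Relation.Unary.AllPairs.Properties as AllPairs
open import Data.List.Relation.Unary.Any as Any using (Any; here; there)
open import Data.List.Relation.Unary.Unique.Propositional using (Unique)
import Data.List.Relation.Unary.Unique.Propositional.Properties as Unique
open import Data.Nat using (ℕ; zero; suc; _+_; _*_; _≤_; _<_; z≤n; s≤s; _<?_; _≡ᵇ_; _≤ᵇ_)
open import Data.Nat.ListAction using (sum)
open import Data.Nat.ListAction.Properties using (sum-++)
open import Data.Nat.Properties using (≤-refl; ≤-trans; ≤-reflexive; ≤-antisym; <-irrefl; <-asym; ≮⇒≥; <-≤-trans; n≤1+n; m≤n⇒m≤1+n; m≤n⇒m<n∨m≡n; m≤m+n; m≤n+m; n≤0⇒n≡0; 1+n≢0; +-mono-≤; +-monoʳ-≤; *-monoʳ-≤; +-assoc; +-identityʳ; *-zeroʳ; *-distribˡ-+; *-distribʳ-+; ≡ᵇ⇒≡; ≡⇒≡ᵇ; ≤ᵇ⇒≤; ≤⇒≤ᵇ; +-commutativeSemigroup; module ≤-Reasoning)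
open import Algebra.Properties.CommutativeSemigroup +-commutativeSemigroup using (interchange)
open import Data.Nat.Tactic.RingSolver using (solve-∀)
open import Data.Product using (Σ; ∃; _×_; _,_; proj₁; proj₂; map₁)
import Data.Product.Properties as Product
open import Data.Sum using (_⊎_; inj₁; inj₂)
open import Data.Vec using (Vec; []; _∷_; lookup; tabulate; replicate; zipWith)
open import Data.Vec.Properties using (lookup-zipWith; lookup∘tabulate; lookup-replicate)
import Data.Vec.Properties as Vec
open import Function using (_∘′_)
open import Level using (0ℓ)
open import Relation.Binary.Bundles using (Setoid)
open import Relation.Binary.Definitions using (DecidableEquality; tri<; tri≈; tri>)
open import Relation.Binary.PropositionalEquality using (_≡_; _≢_; refl; sym; trans; cong; cong₂; subst; module ≡-Reasoning)
open import Relation.Nullary using (¬_; yes; no; does; ¬?)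
open import Relation.Nullary.Decidable using (dec-true; dec-false)

module _ {A B : Set} where

  ∈-concatMap⁺′ : {f : A → List B} {x : A} {xs : List A} {y : B} →
                  x ∈ xs → y ∈ f x → y ∈ concatMap f xs
  ∈-concatMap⁺′ {f} x∈ y∈ = ∈-concatMap⁺ f (lose x∈ y∈)

  ∈-concatMap⁻′ : {f : A → List B} {y : B} (xs : List A) →
                  y ∈ concatMap f xs → ∃ λ x → x ∈ xs × y ∈ f x
  ∈-concatMap⁻′ {f} _ y∈ = find (∈-concatMap⁻ f y∈)

no-member⇒[] : {A : Set} (xs : List A) → (∀ {x} → ¬ (x ∈ xs)) → xs ≡ []
no-member⇒[] [] _ = refl
no-member⇒[] (x ∷ xs) ∉xs = ⊥-elim (∉xs (here refl))

∈-if⁺ : {A : Set} {y : A} {xs : List A} (c : Bool) → c ≡ true → y ∈ xs → y ∈ (if c then xs else [])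
∈-if⁺ true _ y∈ = y∈

∈-if⁻ : {A : Set} {y : A} {xs : List A} (c : Bool) → y ∈ (if c then xs else []) → c ≡ true × y ∈ xs
∈-if⁻ true y∈ = refl , y∈


module _ {A Col : Set} (_≟A_ : DecidableEquality A) (_≟C_ : DecidableEquality Col) (col : A → Col) where

  ∈-filterᵇ⁻ : ∀ {p : A → Bool} {y} xs → y ∈ filterᵇ _≟A_ _≟C_ col p xs → y ∈ xs × p y ≡ true
  ∈-filterᵇ⁻ {p} (x ∷ xs) y∈ with p x in px
  ∈-filterᵇ⁻ {p} (x ∷ xs) (here refl) | true = here refl , px
  ∈-filterᵇ⁻ {p} (x ∷ xs) (there y∈)  | true = map₁ there (∈-filterᵇ⁻ xs y∈)
  ∈-filterᵇ⁻ {p} (x ∷ xs) y∈          | false = map₁ there (∈-filterᵇ⁻ xs y∈)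

  ∈-filterᵇ⁺ : ∀ {p : A → Bool} {y} xs → y ∈ xs → p y ≡ true → y ∈ filterᵇ _≟A_ _≟C_ col p xs
  ∈-filterᵇ⁺ {p} (x ∷ xs) y∈ py with p x in px
  ∈-filterᵇ⁺ {p} (x ∷ xs) (here refl) py | true = here refl
  ∈-filterᵇ⁺ {p} (x ∷ xs) (there y∈)  py | true = there (∈-filterᵇ⁺ xs y∈ py)
  ∈-filterᵇ⁺ {p} (x ∷ xs) (here refl) py | false with () ← trans (sym py) px
  ∈-filterᵇ⁺ {p} (x ∷ xs) (there y∈)  py | false = ∈-filterᵇ⁺ xs y∈ py

∧-true⁻ : ∀ {x y} → x ∧ y ≡ true → x ≡ true × y ≡ true
∧-true⁻ {true} eq = refl , eq

∧-true⁺ : ∀ {x y} → x ≡ true → y ≡ true → x ∧ y ≡ true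
∧-true⁺ refl refl = refl

∨-true⁻ : ∀ {x y} → x ∨ y ≡ true → x ≡ true ⊎ y ≡ true
∨-true⁻ {true} _ = inj₁ refl
∨-true⁻ {false} eq = inj₂ eq

≡true⇒T : ∀ {x} → x ≡ true → T x
≡true⇒T refl = _

T⇒≡true : ∀ {x} → T x → x ≡ true
T⇒≡true {true} _ = refl

not-true⁻ : ∀ {x} → not x ≡ true → x ≡ false
not-true⁻ {false} _ = refl

xor-true : ∀ x → x xor true ≡ not x
xor-true true = refl
xor-true false = refl

not-xor-true : ∀ x → not (x xor true) ≡ x
not-xor-true true = refl
not-xor-true false = refl

≢-true-false : ∀ {x y} → x ≡ true → y ≡ false → x ≢ y
≢-true-false refl refl ()

module _ {n : ℕ} where

  ==⇒≡ : (u v : Fin n) → (u == v) ≡ true → u ≡ v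
  ==⇒≡ u v eq with u ≟ᶠ v
  ... | yes u≡v = u≡v

  ==-refl : (u : Fin n) → (u == u) ≡ true
  ==-refl u = dec-true (u ≟ᶠ u) refl

  ≢⇒==false : {u v : Fin n} → u ≢ v → (u == v) ≡ false
  ≢⇒==false {u} {v} u≢v = dec-false (u ≟ᶠ v) u≢v

_⊆ᵇ_ : ∀ {k} → Vec Bool k → Vec Bool k → Set
S ⊆ᵇ M = ∀ i → lookup S i ≡ true → lookup M i ≡ true

∅ᵇ : ∀ {k} → Vec Bool k
∅ᵇ {k} = replicate k false

count-∅ᵇ : ∀ k → count (∅ᵇ {k}) ≡ 0
count-∅ᵇ zero = refl
count-∅ᵇ (suc k) = count-∅ᵇ k

∅ᵇ-even : ∀ {k} → isEven (count (∅ᵇ {k})) ≡ true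
∅ᵇ-even {k} = cong isEven (count-∅ᵇ k)

∈-subsetsOf⁻ : ∀ {k} {S : Vec Bool k} (M : Vec Bool k) → S ∈ subsetsOf M → S ⊆ᵇ M
∈-subsetsOf⁻ {S = []} [] _ ()
∈-subsetsOf⁻ (true ∷ M) S∈ with ∈-++⁻ (map (true ∷_) (subsetsOf M)) S∈
... | inj₁ S∈′ with ∈-map⁻ (true ∷_) S∈′
...   | _ , S′∈ , refl = λ { zero _ → refl ; (suc i) → ∈-subsetsOf⁻ M S′∈ i }
∈-subsetsOf⁻ (true ∷ M) S∈ | inj₂ S∈′ with ∈-map⁻ (false ∷_) S∈′
...   | _ , S′∈ , refl = λ { zero _ → refl ; (suc i) → ∈-subsetsOf⁻ M S′∈ i }
∈-subsetsOf⁻ (false ∷ M) S∈ with ∈-map⁻ (false ∷_) S∈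
... | _ , S′∈ , refl = λ { zero () ; (suc i) → ∈-subsetsOf⁻ M S′∈ i }

∈-subsetsOf⁺ : ∀ {k} (S M : Vec Bool k) → S ⊆ᵇ M → S ∈ subsetsOf M
∈-subsetsOf⁺ [] [] _ = here refl
∈-subsetsOf⁺ (true ∷ S) (true ∷ M) S⊆ = ∈-++⁺ˡ (∈-map⁺ (true ∷_) (∈-subsetsOf⁺ S M (λ i → S⊆ (suc i))))
∈-subsetsOf⁺ (false ∷ S) (true ∷ M) S⊆ =
  ∈-++⁺ʳ (map (true ∷_) (subsetsOf M)) (∈-map⁺ (false ∷_) (∈-subsetsOf⁺ S M (λ i → S⊆ (suc i))))
∈-subsetsOf⁺ (true ∷ S) (false ∷ M) S⊆ with () ← S⊆ zero refl
∈-subsetsOf⁺ (false ∷ S) (false ∷ M) S⊆ = ∈-map⁺ (false ∷_) (∈-subsetsOf⁺ S M (λ i → S⊆ (suc i)))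

∅ᵇ-⊆ᵇ : ∀ {k} (M : Vec Bool k) → ∅ᵇ ⊆ᵇ M
∅ᵇ-⊆ᵇ M i eq with () ← trans (sym (lookup-replicate i false)) eq

isEven-count-xor : ∀ {k} (S T : Vec Bool k) →
                   isEven (count (zipWith _xor_ S T)) ≡ not (isEven (count S) xor isEven (count T))
isEven-count-xor [] [] = refl
isEven-count-xor (true ∷ S) (true ∷ T) =
  trans (isEven-count-xor S T) (cong not (sym (xor-annihilates-not (isEven (count S)) (isEven (count T)))))
isEven-count-xor (true ∷ S) (false ∷ T) = cong not (trans (isEven-count-xor S T) (not-distribˡ-xor (isEven (count S)) (isEven (count T))))
isEven-count-xor (false ∷ S) (true ∷ T) = cong not (trans (isEven-count-xor S T) (not-distribʳ-xor (isEven (count S)) (isEven (count T))))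
isEven-count-xor (false ∷ S) (false ∷ T) = isEven-count-xor S T

even-xor : ∀ {k} (S T : Vec Bool k) → isEven (count S) ≡ true → isEven (count T) ≡ true →
           isEven (count (zipWith _xor_ S T)) ≡ true
even-xor S T eS eT rewrite isEven-count-xor S T | eS | eT = refl

zipWith-xor-cancelʳ : ∀ {k} (S T : Vec Bool k) → zipWith _xor_ (zipWith _xor_ S T) T ≡ S
zipWith-xor-cancelʳ [] [] = refl
zipWith-xor-cancelʳ (s ∷ S) (t ∷ T) =
  cong₂ _∷_ (trans (xor-assoc s t t) (trans (cong (s xor_) (xor-same t)) (xor-identityʳ s))) (zipWith-xor-cancelʳ S T)

count≤length : ∀ {k} (S : Vec Bool k) → count S ≤ k
count≤length [] = z≤n
count≤length (true ∷ S) = s≤s (count≤length S)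
count≤length (false ∷ S) = m≤n⇒m≤1+n (count≤length S)

count-mono : ∀ {k} (S U : Vec Bool k) → S ⊆ᵇ U → count S ≤ count U
count-mono [] [] _ = z≤n
count-mono (true ∷ S) (true ∷ U) S⊆ = s≤s (count-mono S U (λ i → S⊆ (suc i)))
count-mono (true ∷ S) (false ∷ U) S⊆ with () ← S⊆ zero refl
count-mono (false ∷ S) (true ∷ U) S⊆ = m≤n⇒m≤1+n (count-mono S U (λ i → S⊆ (suc i)))
count-mono (false ∷ S) (false ∷ U) S⊆ = count-mono S U (λ i → S⊆ (suc i))

count-strict : ∀ {k} (S U : Vec Bool k) → S ⊆ᵇ U → (j : Fin k) →
               lookup S j ≡ false → lookup U j ≡ true → count S < count U
count-strict (false ∷ S) (true ∷ U) S⊆ zero _ _ = s≤s (count-mono S U (λ i → S⊆ (suc i)))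
count-strict (true ∷ S) (true ∷ U) S⊆ (suc j) Sj Uj = s≤s (count-strict S U (λ i → S⊆ (suc i)) j Sj Uj)
count-strict (true ∷ S) (false ∷ U) S⊆ (suc j) _ _ with () ← S⊆ zero refl
count-strict (false ∷ S) (true ∷ U) S⊆ (suc j) Sj Uj = m≤n⇒m≤1+n (count-strict S U (λ i → S⊆ (suc i)) j Sj Uj)
count-strict (false ∷ S) (false ∷ U) S⊆ (suc j) Sj Uj = count-strict S U (λ i → S⊆ (suc i)) j Sj Uj

count-pos : ∀ {k} (U : Vec Bool k) (j : Fin k) → lookup U j ≡ true → 1 ≤ count U
count-pos (true ∷ U) _ _ = s≤s z≤n
count-pos (false ∷ U) (suc j) Uj = count-pos U j Uj

nonempty-member : ∀ {k} (S : Vec Bool k) → S ≢ ∅ᵇ → ∃ λ w → lookup S w ≡ true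
nonempty-member [] S≢∅ = ⊥-elim (S≢∅ refl)
nonempty-member (true ∷ S) _ = zero , refl
nonempty-member (false ∷ S) S≢∅ with nonempty-member S (λ eq → S≢∅ (cong (false ∷_) eq))
... | w , Sw = suc w , Sw

even-nonempty-other : ∀ {k} (S : Vec Bool k) (z : Fin k) → isEven (count S) ≡ true → S ≢ ∅ᵇ →
                      ∃ λ w → lookup S w ≡ true × w ≢ z
even-nonempty-other {suc k} (true ∷ S) zero eS S≢∅ with Vec.≡-dec _≟ᵇ_ S ∅ᵇ
... | yes refl with () ← trans (sym (cong (λ c → not (isEven c)) (count-∅ᵇ k))) eS
... | no S≢∅′ with nonempty-member S S≢∅′
...   | w , Sw = suc w , Sw , λ ()
even-nonempty-other (false ∷ S) zero eS S≢∅ with nonempty-member S (λ eq → S≢∅ (cong (false ∷_) eq))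
... | w , Sw = suc w , Sw , λ ()
even-nonempty-other (true ∷ S) (suc z) _ _ = zero , refl , λ ()
even-nonempty-other (false ∷ S) (suc z) eS S≢∅ with even-nonempty-other S z eS (λ eq → S≢∅ (cong (false ∷_) eq))
... | w , Sw , w≢z = suc w , Sw , λ eq → w≢z (suc-injective eq)

indicator : Bool → ℕ
indicator true = 1
indicator false = 0

indicator≤1 : ∀ t → indicator t ≤ 1
indicator≤1 true = ≤-refl
indicator≤1 false = z≤n

module _ {A : Set} where

  sum-map-mono : ∀ {f g : A → ℕ} (xs : List A) → (∀ x → f x ≤ g x) → sum (map f xs) ≤ sum (map g xs)
  sum-map-mono [] _ = z≤n
  sum-map-mono (x ∷ xs) f≤g = +-mono-≤ (f≤g x) (sum-map-mono xs f≤g)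

  sum-map-cong : ∀ {f g : A → ℕ} (xs : List A) → (∀ x → f x ≡ g x) → sum (map f xs) ≡ sum (map g xs)
  sum-map-cong [] _ = refl
  sum-map-cong (x ∷ xs) f≡g = cong₂ _+_ (f≡g x) (sum-map-cong xs f≡g)

  sum-map-+ : ∀ (f g : A → ℕ) (xs : List A) → sum (map (λ x → f x + g x) xs) ≡ sum (map f xs) + sum (map g xs)
  sum-map-+ f g [] = refl
  sum-map-+ f g (x ∷ xs) rewrite sum-map-+ f g xs = interchange (f x) (g x) _ _

  sum-map-* : ∀ k (f : A → ℕ) (xs : List A) → sum (map (λ x → k * f x) xs) ≡ k * sum (map f xs)
  sum-map-* k f [] = sym (*-zeroʳ k)
  sum-map-* k f (x ∷ xs) rewrite sum-map-* k f xs = sym (*-distribˡ-+ k (f x) _)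

  ∈⇒≤sum-map : ∀ (f : A → ℕ) {x} {xs : List A} → x ∈ xs → f x ≤ sum (map f xs)
  ∈⇒≤sum-map f (here refl) = m≤m+n _ _
  ∈⇒≤sum-map f {xs = y ∷ ys} (there x∈) = ≤-trans (∈⇒≤sum-map f x∈) (m≤n+m _ (f y))

  module _ {B : Set} where

    sum-map-concatMap : ∀ (g : B → ℕ) (f : A → List B) (xs : List A) →
                        sum (map g (concatMap f xs)) ≡ sum (map (λ x → sum (map g (f x))) xs)
    sum-map-concatMap g f [] = refl
    sum-map-concatMap g f (x ∷ xs)
      rewrite map-++ g (f x) (concatMap f xs) | sum-++ (map g (f x)) (map g (concatMap f xs))
            | sum-map-concatMap g f xs = refl

    length-concatMap : ∀ (f : A → List B) (xs : List A) → length (concatMap f xs) ≡ sum (map (λ x → length (f x)) xs)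
    length-concatMap f [] = refl
    length-concatMap f (x ∷ xs) rewrite length-++ (f x) {concatMap f xs} | length-concatMap f xs = refl

    sum-map-map : ∀ (g : B → ℕ) (h : A → B) (xs : List A) → sum (map g (map h xs)) ≡ sum (map (λ x → g (h x)) xs)
    sum-map-map g h [] = refl
    sum-map-map g h (x ∷ xs) = cong (g (h x) +_) (sum-map-map g h xs)

unique-concatMap : {A B : Set} {f : A → List B} {xs : List A} → Unique xs → (∀ x → Unique (f x)) →
                   (∀ {x y z} → z ∈ f x → z ∈ f y → x ≡ y) → Unique (concatMap f xs)
unique-concatMap [] _ _ = []
unique-concatMap {f = f} {x ∷ xs} (x∉xs ∷ unique-xs) unique-f owner =
  Unique.++⁺ (unique-f x) (unique-concatMap unique-xs unique-f owner) λ (z∈fx , z∈rest) →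
    let (y , y∈ , z∈fy) = ∈-concatMap⁻′ xs z∈rest in All.lookup x∉xs y∈ (owner z∈fx z∈fy)

unique-if : {A : Set} (c : Bool) {xs : List A} → Unique xs → Unique (if c then xs else [])
unique-if true u = u
unique-if false _ = []

unique-subsetsOf : ∀ {k} (M : Vec Bool k) → Unique (subsetsOf M)
unique-subsetsOf [] = All.[] ∷ []
unique-subsetsOf {suc k} (true ∷ M) =
  Unique.++⁺ (Unique.map⁺ ∷-injectiveʳ (unique-subsetsOf M)) (Unique.map⁺ ∷-injectiveʳ (unique-subsetsOf M)) heads-differ
  where
    ∷-injectiveʳ : ∀ {h} {S S′ : Vec Bool k} → h ∷ S ≡ h ∷ S′ → S ≡ S′
    ∷-injectiveʳ refl = refl
    heads-differ : ∀ {S} → ¬ (S ∈ map (true ∷_) (subsetsOf M) × S ∈ map (false ∷_) (subsetsOf M))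
    heads-differ (S∈₁ , S∈₂) with ∈-map⁻ (true ∷_) S∈₁ | ∈-map⁻ (false ∷_) S∈₂
    ... | _ , _ , refl | _ , _ , ()
unique-subsetsOf (false ∷ M) = Unique.map⁺ (λ { refl → refl }) (unique-subsetsOf M)

module _ {A : Set} (_≈_ : A → A → Set) (≈-sym : ∀ {x y} → x ≈ y → y ≈ x)
         (≈-trans : ∀ {x y z} → x ≈ y → y ≈ z → x ≈ z) where

  private
    delete : {P : A → Set} (ys : List A) → Any P ys → List A
    delete (y ∷ ys) (here _) = ys
    delete (y ∷ ys) (there p) = y ∷ delete ys p

    length-delete : {P : A → Set} (ys : List A) (p : Any P ys) → suc (length (delete ys p)) ≡ length ys
    length-delete (y ∷ ys) (here _) = refl
    length-delete (y ∷ ys) (there p) = cong suc (length-delete ys p)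

    delete-keeps : ∀ {x x′} (ys : List A) (p : Any (x ≈_) ys) → Any (x′ ≈_) ys → ¬ (x ≈ x′) →
                   Any (x′ ≈_) (delete ys p)
    delete-keeps (y ∷ ys) (here x≈y) (here x′≈y) x≉x′ = ⊥-elim (x≉x′ (≈-trans x≈y (≈-sym x′≈y)))
    delete-keeps (y ∷ ys) (here _) (there q) _ = q
    delete-keeps (y ∷ ys) (there p) (here x′≈y) _ = here x′≈y
    delete-keeps (y ∷ ys) (there p) (there q) x≉x′ = there (delete-keeps ys p q x≉x′)

  pigeonhole : (xs ys : List A) → AllPairs (λ x x′ → ¬ (x ≈ x′)) xs →
               (∀ {x} → x ∈ xs → Any (x ≈_) ys) → length xs ≤ length ys
  pigeonhole [] ys _ _ = z≤n
  pigeonhole (x ∷ xs) ys (x≉xs ∷ distinct) covered =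
    subst (suc (length xs) ≤_) (length-delete ys p)
      (s≤s (pigeonhole xs (delete ys p) distinct
              (λ x′∈ → delete-keeps ys p (covered (there x′∈)) (All.lookup x≉xs x′∈))))
    where p = covered (here refl)

module Derivations {V : Set} (_≟V_ : DecidableEquality V) (F : Formula V) where

  private
    _≟ℓ_ : DecidableEquality (Lit V)
    _≟ℓ_ = _≟ˡ_ _≟V_

    without : Lit V → Clause V → Clause V
    without ℓ₀ = filter (λ ℓ → ¬? (ℓ ≟ℓ ℓ₀))

  resolve : Clause V → Clause V → V → Clause V
  resolve C₁ C₂ x = without (pos x) C₁ ++ without (neg x) C₂

  ∈-resolve⁻ : ∀ {C₁ C₂ x ℓ} → ℓ ∈ resolve C₁ C₂ x → (ℓ ∈ C₁ × ℓ ≢ pos x) ⊎ (ℓ ∈ C₂ × ℓ ≢ neg x)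
  ∈-resolve⁻ {C₁} {C₂} {x} ℓ∈ with ∈-++⁻ (without (pos x) C₁) ℓ∈
  ... | inj₁ ℓ∈₁ = inj₁ (∈-filter⁻ (λ ℓ → ¬? (ℓ ≟ℓ pos x)) ℓ∈₁)
  ... | inj₂ ℓ∈₂ = inj₂ (∈-filter⁻ (λ ℓ → ¬? (ℓ ≟ℓ neg x)) ℓ∈₂)

  ∈-resolve⁺ : ∀ {C₁ C₂ x ℓ} → (ℓ ∈ C₁ × ℓ ≢ pos x) ⊎ (ℓ ∈ C₂ × ℓ ≢ neg x) → ℓ ∈ resolve C₁ C₂ x
  ∈-resolve⁺ {C₁} {C₂} {x} (inj₁ (ℓ∈ , ℓ≢)) = ∈-++⁺ˡ (∈-filter⁺ (λ ℓ → ¬? (ℓ ≟ℓ pos x)) ℓ∈ ℓ≢)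
  ∈-resolve⁺ {C₁} {C₂} {x} (inj₂ (ℓ∈ , ℓ≢)) = ∈-++⁺ʳ (without (pos x) C₁) (∈-filter⁺ (λ ℓ → ¬? (ℓ ≟ℓ neg x)) ℓ∈ ℓ≢)

  resolve-isResolvent : ∀ {C₁ C₂ x} → pos x ∈ C₁ → neg x ∈ C₂ → IsResolvent C₁ C₂ (resolve C₁ C₂ x)
  resolve-isResolvent {x = x} x∈ x̄∈ = x , x∈ , x̄∈ , λ ℓ → ∈-resolve⁻ , ∈-resolve⁺

  Context : Set
  Context = List (Clause V)

  derivFrom-++ : ∀ {Γ cs ds} → SRC-I-DerivFrom F Γ cs → SRC-I-DerivFrom F (Γ ++ cs) ds → SRC-I-DerivFrom F Γ (cs ++ ds)
  derivFrom-++ {Γ} {ds = ds} done d = subst (λ Δ → SRC-I-DerivFrom F Δ ds) (++-identityʳ Γ) d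
  derivFrom-++ {Γ} {c ∷ cs} {ds} (step s d) d′ =
    step s (derivFrom-++ d (subst (λ Δ → SRC-I-DerivFrom F Δ ds) (sym (++-assoc Γ (c ∷ []) cs)) d′))

  -- Extensions of the available clauses Γ by at most b derived clauses; they compose like a
  -- state monad graded by length.
  record Derivation (Γ : Context) (P : Context → Set) (b : ℕ) : Set where
    constructor derivation
    field
      derived : List (Clause V)
      steps   : SRC-I-DerivFrom F Γ derived
      length≤ : length derived ≤ b
      post    : P (Γ ++ derived)

  _>>=_ : ∀ {Γ P Q b b′} → Derivation Γ P b → (∀ Γ′ → Γ ⊆ Γ′ → P Γ′ → Derivation Γ′ Q b′) → Derivation Γ Q (b + b′)
  _>>=_ {Γ} {Q = Q} (derivation cs d l p) k with k (Γ ++ cs) ∈-++⁺ˡ p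
  ... | derivation ds d′ l′ p′ =
    derivation (cs ++ ds) (derivFrom-++ d d′) (subst (_≤ _) (sym (length-++ cs)) (+-mono-≤ l l′)) (subst Q (++-assoc Γ cs ds) p′)

  return : ∀ {Γ P} → P Γ → Derivation Γ P 0
  return {Γ} {P} p = derivation [] done z≤n (subst P (sym (++-identityʳ Γ)) p)

  relax : ∀ {Γ P b b′} → b ≤ b′ → Derivation Γ P b → Derivation Γ P b′
  relax b≤b′ (derivation cs d l p) = derivation cs d (≤-trans l b≤b′) p

  post-map : ∀ {Γ P Q b} → (∀ Γ′ → Γ ⊆ Γ′ → P Γ′ → Q Γ′) → Derivation Γ P b → Derivation Γ Q b
  post-map {Γ} f (derivation cs d l p) = derivation cs d l (f (Γ ++ cs) ∈-++⁺ˡ p)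

  derive : ∀ {Γ D} → SRC-I-Step F Γ D → Derivation Γ (D ∈_) 1
  derive {Γ} s = derivation (_ ∷ []) (step s done) ≤-refl (∈-++⁺ʳ Γ (here refl))

  resolveStep : ∀ {Γ C₁ C₂ x} → C₁ ∈ Γ → C₂ ∈ Γ → pos x ∈ C₁ → neg x ∈ C₂ → Derivation Γ (resolve C₁ C₂ x ∈_) 1
  resolveStep C₁∈ C₂∈ x∈ x̄∈ = derive (resolution C₁∈ C₂∈ (resolve-isResolvent x∈ x̄∈))

  forEach : {A : Set} (xs : List A) (cost : A → ℕ) (Inv : Context → Set) (Q : A → Context → Set) →
            (∀ {Γ Γ′} → Γ ⊆ Γ′ → Inv Γ → Inv Γ′) → (∀ {x Γ Γ′} → Γ ⊆ Γ′ → Q x Γ → Q x Γ′) →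
            (∀ Γ x → x ∈ xs → Inv Γ → Derivation Γ (Q x) (cost x)) →
            ∀ {Γ} → Inv Γ → Derivation Γ (λ Γ′ → Inv Γ′ × (∀ {x} → x ∈ xs → Q x Γ′)) (sum (map cost xs))
  forEach [] cost Inv Q _ _ _ inv = return (inv , λ ())
  forEach (x ∷ xs) cost Inv Q Inv-mono Q-mono body {Γ} inv =
    body Γ x (here refl) inv >>= λ Γ₁ Γ⊆Γ₁ qx →
    post-map (λ Γ₂ Γ₁⊆Γ₂ (inv₂ , qs) → inv₂ , λ { (here refl) → Q-mono Γ₁⊆Γ₂ qx ; (there y∈) → qs y∈ })
      (forEach xs cost Inv Q Inv-mono Q-mono (λ Γ′ y y∈ → body Γ′ y (there y∈)) (Inv-mono Γ⊆Γ₁ inv))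

-- The isomorphism formula and its symmetries

module IsoFormulaProperties {A Col : Set} (_≟A_ : DecidableEquality A) (_≟C_ : DecidableEquality Col) (col : A → Col) where

  compatible : A → A → Bool
  compatible = compat _≟A_ _≟C_ col

  type1Clause : List A → A → Clause (A × A)
  type1Clause V₂ v₁ = map (λ v₂ → pos (v₁ , v₂)) (filterᵇ _≟A_ _≟C_ col (compatible v₁) V₂)

  type2Condition : A → A → A → Bool
  type2Condition v₁ v₁′ v₂ = not (does (v₁ ≟A v₁′)) ∧ compatible v₁ v₂ ∧ compatible v₁′ v₂

  type3Condition : (A → A → Bool) → (A → A → Bool) → A → A → A → A → Bool
  type3Condition E₁ E₂ u₁ v₁ u₂ v₂ = compatible u₁ u₂ ∧ compatible v₁ v₂ ∧ (E₁ u₁ v₁ xor E₂ u₂ v₂)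

  compatible-cong : ∀ {x x′ y y′} → col x ≡ col x′ → col y ≡ col y′ → compatible x y ≡ compatible x′ y′
  compatible-cong x≡ y≡ rewrite x≡ | y≡ = refl

  compatible⇒≡ : ∀ {x y} → compatible x y ≡ true → col x ≡ col y
  compatible⇒≡ {x} {y} eq with col x ≟C col y
  ... | yes x≡y = x≡y

  ≡⇒compatible : ∀ {x y} → col x ≡ col y → compatible x y ≡ true
  ≡⇒compatible {x} {y} = dec-true (col x ≟C col y)

  ∈-type1Clause⁻ : ∀ {V₂ v₁ ℓ} → ℓ ∈ type1Clause V₂ v₁ → ∃ λ v₂ → ℓ ≡ pos (v₁ , v₂) × v₂ ∈ V₂ × col v₁ ≡ col v₂
  ∈-type1Clause⁻ {V₂} {v₁} ℓ∈ with ∈-map⁻ (λ v₂ → pos (v₁ , v₂)) ℓ∈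
  ... | v₂ , v₂∈ , refl with ∈-filterᵇ⁻ _≟A_ _≟C_ col V₂ v₂∈
  ...   | v₂∈V₂ , c = v₂ , refl , v₂∈V₂ , compatible⇒≡ c

  ∈-type1Clause⁺ : ∀ {V₂ v₁ v₂} → v₂ ∈ V₂ → col v₁ ≡ col v₂ → pos (v₁ , v₂) ∈ type1Clause V₂ v₁
  ∈-type1Clause⁺ {V₂} {v₁} v₂∈ eq = ∈-map⁺ (λ v₂ → pos (v₁ , v₂)) (∈-filterᵇ⁺ _≟A_ _≟C_ col V₂ v₂∈ (≡⇒compatible eq))

  module _ (V₁ V₂ : List A) (E₁ E₂ : A → A → Bool) where

    private
      F : Formula (A × A)
      F = IsoFormula _≟A_ _≟C_ col V₁ V₂ E₁ E₂

    type1∈ : ∀ {v₁} → v₁ ∈ V₁ → type1Clause V₂ v₁ ∈ F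
    type1∈ v₁∈ = ∈-++⁺ˡ (∈-map⁺ _ v₁∈)

    type2∈ : ∀ {v₁ v₁′ v₂} → v₂ ∈ V₂ → v₁ ∈ V₁ → v₁′ ∈ V₁ → type2Condition v₁ v₁′ v₂ ≡ true →
             (neg (v₁ , v₂) ∷ neg (v₁′ , v₂) ∷ []) ∈ F
    type2∈ {v₁} {v₁′} {v₂} v₂∈ v₁∈ v₁′∈ c =
      ∈-++⁺ʳ (type1 _≟A_ _≟C_ col V₁ V₂) (∈-++⁺ˡ
        (∈-concatMap⁺′ v₂∈ (∈-concatMap⁺′ v₁∈ (∈-concatMap⁺′ v₁′∈ (∈-if⁺ (type2Condition v₁ v₁′ v₂) c (here refl))))))

    type3∈ : ∀ {u₁ v₁ u₂ v₂} → u₁ ∈ V₁ → v₁ ∈ V₁ → u₂ ∈ V₂ → v₂ ∈ V₂ → type3Condition E₁ E₂ u₁ v₁ u₂ v₂ ≡ true →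
             (neg (u₁ , u₂) ∷ neg (v₁ , v₂) ∷ []) ∈ F
    type3∈ {u₁} {v₁} {u₂} {v₂} u₁∈ v₁∈ u₂∈ v₂∈ c =
      ∈-++⁺ʳ (type1 _≟A_ _≟C_ col V₁ V₂) (∈-++⁺ʳ (type2 _≟A_ _≟C_ col V₁ V₂)
        (∈-concatMap⁺′ u₁∈ (∈-concatMap⁺′ v₁∈ (∈-concatMap⁺′ u₂∈ (∈-concatMap⁺′ v₂∈
          (∈-if⁺ (type3Condition E₁ E₂ u₁ v₁ u₂ v₂) c (here refl)))))))

    data IsoClause : Clause (A × A) → Set where
      type1-clause : ∀ {v₁} → v₁ ∈ V₁ → IsoClause (type1Clause V₂ v₁)
      type2-clause : ∀ {v₁ v₁′ v₂} → v₂ ∈ V₂ → v₁ ∈ V₁ → v₁′ ∈ V₁ → type2Condition v₁ v₁′ v₂ ≡ true →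
              IsoClause (neg (v₁ , v₂) ∷ neg (v₁′ , v₂) ∷ [])
      type3-clause : ∀ {u₁ v₁ u₂ v₂} → u₁ ∈ V₁ → v₁ ∈ V₁ → u₂ ∈ V₂ → v₂ ∈ V₂ → type3Condition E₁ E₂ u₁ v₁ u₂ v₂ ≡ true →
              IsoClause (neg (u₁ , u₂) ∷ neg (v₁ , v₂) ∷ [])

    isoClause : ∀ {C} → C ∈ F → IsoClause C
    isoClause C∈ with ∈-++⁻ (type1 _≟A_ _≟C_ col V₁ V₂) C∈
    ... | inj₁ C∈₁ with ∈-map⁻ (type1Clause V₂) C∈₁
    ...   | _ , v₁∈ , refl = type1-clause v₁∈
    isoClause C∈ | inj₂ C∈′ with ∈-++⁻ (type2 _≟A_ _≟C_ col V₁ V₂) C∈′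
    ... | inj₁ C∈₂ with ∈-concatMap⁻′ V₂ C∈₂
    ...   | v₂ , v₂∈ , C∈₂′ with ∈-concatMap⁻′ V₁ C∈₂′
    ...     | v₁ , v₁∈ , C∈₂″ with ∈-concatMap⁻′ V₁ C∈₂″
    ...       | v₁′ , v₁′∈ , C∈₂‴ with ∈-if⁻ (type2Condition v₁ v₁′ v₂) C∈₂‴
    ...         | c , here refl = type2-clause v₂∈ v₁∈ v₁′∈ c
    isoClause C∈ | inj₂ C∈′ | inj₂ C∈₃ with ∈-concatMap⁻′ V₁ C∈₃
    ... | u₁ , u₁∈ , p₁ with ∈-concatMap⁻′ V₁ p₁
    ...   | v₁ , v₁∈ , p₂ with ∈-concatMap⁻′ V₂ p₂
    ...     | u₂ , u₂∈ , p₃ with ∈-concatMap⁻′ V₂ p₃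
    ...       | v₂ , v₂∈ , p₄ with ∈-if⁻ (type3Condition E₁ E₂ u₁ v₁ u₂ v₂) p₄
    ...         | c , here refl = type3-clause u₁∈ v₁∈ u₂∈ v₂∈ c

    -- An automorphism ψ of the coloured graph (V₂, E₂) induces the renaming x_{v₁,v₂} ↦ x_{v₁,ψ v₂},
    -- which maps every clause of F to a clause of F.
    module SecondCoordinateSymmetry (ψ : A → A) (ψ-involutive : ∀ x → ψ (ψ x) ≡ x) (ψ-∈ : ∀ {x} → x ∈ V₂ → ψ x ∈ V₂)
             (ψ-col : ∀ x → col (ψ x) ≡ col x) (ψ-edge : ∀ x y → E₂ (ψ x) (ψ y) ≡ E₂ x y) where

      ψˡ : Lit (A × A) → Lit (A × A)
      ψˡ (pos (x , y)) = pos (x , ψ y)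
      ψˡ (neg (x , y)) = neg (x , ψ y)

      ψˡ-involutive : ∀ ℓ → ψˡ (ψˡ ℓ) ≡ ℓ
      ψˡ-involutive (pos (x , y)) = cong (λ z → pos (x , z)) (ψ-involutive y)
      ψˡ-involutive (neg (x , y)) = cong (λ z → neg (x , z)) (ψ-involutive y)

      ψ-renaming : Renaming (A × A)
      ψ-renaming = record
        { σ = ψˡ ; σ⁻¹ = ψˡ ; inv-l = ψˡ-involutive ; inv-r = ψˡ-involutive
        ; σ-neg = λ { (pos _) → refl ; (neg _) → refl } }

      compatible-ψ : ∀ x y → compatible x (ψ y) ≡ compatible x y
      compatible-ψ x y = compatible-cong refl (ψ-col y)

      ψ-type1Clause : ∀ {v₁} → rename ψ-renaming (type1Clause V₂ v₁) ≋ type1Clause V₂ v₁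
      ψ-type1Clause {v₁} = to , from
        where
          moved : ∀ {y} → y ∈ V₂ → col v₁ ≡ col y → pos (v₁ , ψ y) ∈ type1Clause V₂ v₁
          moved {y} y∈ eq = ∈-type1Clause⁺ {V₂} (ψ-∈ y∈) (trans eq (sym (ψ-col y)))

          to : rename ψ-renaming (type1Clause V₂ v₁) ⊆ᶜ type1Clause V₂ v₁
          to ℓ∈ with ∈-map⁻ ψˡ ℓ∈
          ... | _ , ℓ′∈ , refl with ∈-type1Clause⁻ {V₂} ℓ′∈
          ...   | y , refl , y∈ , eq = moved y∈ eq

          from : type1Clause V₂ v₁ ⊆ᶜ rename ψ-renaming (type1Clause V₂ v₁)
          from ℓ∈ with ∈-type1Clause⁻ {V₂} ℓ∈
          ... | y , refl , y∈ , eq =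
            subst (λ z → pos (v₁ , z) ∈ rename ψ-renaming (type1Clause V₂ v₁)) (ψ-involutive y) (∈-map⁺ ψˡ (moved y∈ eq))

      mapsInto : MapsInto ψ-renaming F F
      mapsInto C∈ with isoClause C∈
      ... | type1-clause v₁∈ = _ , type1∈ v₁∈ , ψ-type1Clause
      ... | type2-clause {v₁} {v₁′} {v₂} v₂∈ v₁∈ v₁′∈ c =
        _ , type2∈ (ψ-∈ v₂∈) v₁∈ v₁′∈
              (trans (cong₂ (λ s t → not (does (v₁ ≟A v₁′)) ∧ s ∧ t) (compatible-ψ v₁ v₂) (compatible-ψ v₁′ v₂)) c)
          , (λ ℓ∈ → ℓ∈) , (λ ℓ∈ → ℓ∈)
      ... | type3-clause {u₁} {v₁} {u₂} {v₂} u₁∈ v₁∈ u₂∈ v₂∈ c =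
        _ , type3∈ u₁∈ v₁∈ (ψ-∈ u₂∈) (ψ-∈ v₂∈)
              (trans (cong₂ _∧_ (compatible-ψ u₁ u₂)
                       (cong₂ (λ s t → s ∧ (E₁ u₁ v₁ xor t)) (compatible-ψ v₁ v₂) (ψ-edge u₂ v₂))) c)
          , (λ ℓ∈ → ℓ∈) , (λ ℓ∈ → ℓ∈)

-- CFI graphs and their flip symmetries

colour-ab : ∀ {n} {q : XV n} {c w : Fin n} → cab c w ≡ xcol q → q ≡ a c w ⊎ q ≡ b c w
colour-ab {q = a c w} refl = inj₁ refl
colour-ab {q = b c w} refl = inj₂ refl

colour-m : ∀ {n} {q : XV n} {c : Fin n} → cm c ≡ xcol q → ∃ λ S → q ≡ m c S
colour-m {q = m c S} refl = _ , refl

module CFIProperties {n : ℕ} (G : SimpleGraph n) where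
  open CFI G public

  edgeVertices : Fin n → List (XV n)
  edgeVertices v = concatMap (λ w → if adj G v w then a v w ∷ b v w ∷ [] else []) (allFinList n)

  evenSubsets : Fin n → List (Vec Bool n)
  evenSubsets v = concatMap (λ S → if isEven (count S) then S ∷ [] else []) (subsetsOf (nbrs v))

  middleVertices : Fin n → List (XV n)
  middleVertices v = concatMap (λ S → if isEven (count S) then m v S ∷ [] else []) (subsetsOf (nbrs v))

  IsVertex : XV n → Set
  IsVertex (a v w) = adj G v w ≡ true
  IsVertex (b v w) = adj G v w ≡ true
  IsVertex (m v S) = S ∈ subsetsOf (nbrs v) × isEven (count S) ≡ true

  ∈-gadget⇒∈-vertices : ∀ {x v} → x ∈ gadget v → x ∈ vertices
  ∈-gadget⇒∈-vertices {v = v} = ∈-concatMap⁺′ (∈-allFin v)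

  ∈-vertices⁺ : ∀ x → IsVertex x → x ∈ vertices
  ∈-vertices⁺ (a v w) vw = ∈-gadget⇒∈-vertices {v = v} (∈-++⁺ˡ (∈-concatMap⁺′ (∈-allFin w) (∈-if⁺ (adj G v w) vw (here refl))))
  ∈-vertices⁺ (b v w) vw = ∈-gadget⇒∈-vertices {v = v} (∈-++⁺ˡ (∈-concatMap⁺′ (∈-allFin w) (∈-if⁺ (adj G v w) vw (there (here refl)))))
  ∈-vertices⁺ (m v S) (S∈ , even) =
    ∈-gadget⇒∈-vertices {v = v} (∈-++⁺ʳ (edgeVertices v) (∈-concatMap⁺′ S∈ (∈-if⁺ (isEven (count S)) even (here refl))))

  ∈-vertices⁻ : ∀ {x} → x ∈ vertices → IsVertex x
  ∈-vertices⁻ x∈ with ∈-concatMap⁻′ (allFinList n) x∈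
  ... | v , _ , x∈gadget with ∈-++⁻ (edgeVertices v) x∈gadget
  ...   | inj₁ x∈ab with ∈-concatMap⁻′ (allFinList n) x∈ab
  ...     | w , _ , x∈′ with ∈-if⁻ (adj G v w) x∈′
  ...       | vw , here refl = vw
  ...       | vw , there (here refl) = vw
  ∈-vertices⁻ x∈ | v , _ , x∈gadget | inj₂ x∈m with ∈-concatMap⁻′ (subsetsOf (nbrs v)) x∈m
  ...   | S , S∈ , x∈′ with ∈-if⁻ (isEven (count S)) x∈′
  ...     | even , here refl = S∈ , even

  ∈-evenSubsets⁺ : ∀ {v S} → S ∈ subsetsOf (nbrs v) → isEven (count S) ≡ true → S ∈ evenSubsets v
  ∈-evenSubsets⁺ {S = S} S∈ even = ∈-concatMap⁺′ S∈ (∈-if⁺ (isEven (count S)) even (here refl))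

  ∈-evenSubsets⁻ : ∀ {v S} → S ∈ evenSubsets v → S ∈ subsetsOf (nbrs v) × isEven (count S) ≡ true
  ∈-evenSubsets⁻ {v} S∈ with ∈-concatMap⁻′ (subsetsOf (nbrs v)) S∈
  ... | S , S∈′ , S∈″ with ∈-if⁻ (isEven (count S)) S∈″
  ...   | even , here refl = S∈′ , even

  ∅ᵇ∈subsets : ∀ v → ∅ᵇ ∈ subsetsOf (nbrs v)
  ∅ᵇ∈subsets v = ∈-subsetsOf⁺ ∅ᵇ (nbrs v) (∅ᵇ-⊆ᵇ (nbrs v))

  a∈vertices : ∀ {v w} → adj G v w ≡ true → a v w ∈ vertices
  a∈vertices = ∈-vertices⁺ (a _ _)

  b∈vertices : ∀ {v w} → adj G v w ≡ true → b v w ∈ vertices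
  b∈vertices = ∈-vertices⁺ (b _ _)

  m∈vertices : ∀ {v S} → S ∈ subsetsOf (nbrs v) → isEven (count S) ≡ true → m v S ∈ vertices
  m∈vertices S∈ even = ∈-vertices⁺ (m _ _) (S∈ , even)

  m∅∈vertices : ∀ v → m v ∅ᵇ ∈ vertices
  m∅∈vertices v = m∈vertices (∅ᵇ∈subsets v) (∅ᵇ-even {n})

  ∈-nbrs⇒adj : ∀ {v S w} → S ∈ subsetsOf (nbrs v) → lookup S w ≡ true → adj G v w ≡ true
  ∈-nbrs⇒adj {v} {S} {w} S∈ Sw = trans (sym (lookup∘tabulate (adj G v) w)) (∈-subsetsOf⁻ (nbrs v) S∈ w Sw)

  owner : XV n → Fin n
  owner (a v _) = v
  owner (b v _) = v
  owner (m v _) = v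

  owner-gadget : ∀ {v x} → x ∈ gadget v → owner x ≡ v
  owner-gadget {v} x∈ with ∈-++⁻ (edgeVertices v) x∈
  ... | inj₁ x∈ab with ∈-concatMap⁻′ (allFinList n) x∈ab
  ...   | w , _ , x∈′ with ∈-if⁻ (adj G v w) x∈′
  ...     | _ , here refl = refl
  ...     | _ , there (here refl) = refl
  owner-gadget {v} x∈ | inj₂ x∈m with ∈-concatMap⁻′ (subsetsOf (nbrs v)) x∈m
  ...   | S , _ , x∈′ with ∈-if⁻ (isEven (count S)) x∈′
  ...     | _ , here refl = refl

  unique-gadget : ∀ v → Unique (gadget v)
  unique-gadget v = Unique.++⁺ unique-ab unique-m ab∉m
    where
      ab-neighbour : ∀ {w x} → x ∈ (if adj G v w then a v w ∷ b v w ∷ [] else []) → x ≡ a v w ⊎ x ≡ b v w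
      ab-neighbour {w} x∈ with ∈-if⁻ (adj G v w) x∈
      ... | _ , here refl = inj₁ refl
      ... | _ , there (here refl) = inj₂ refl
      same-neighbour : ∀ {w w′ x} → x ≡ a v w ⊎ x ≡ b v w → x ≡ a v w′ ⊎ x ≡ b v w′ → w ≡ w′
      same-neighbour (inj₁ refl) (inj₁ refl) = refl
      same-neighbour (inj₂ refl) (inj₂ refl) = refl
      unique-ab : Unique (edgeVertices v)
      unique-ab = unique-concatMap (Unique.allFin⁺ n) (λ w → unique-if (adj G v w) (((λ ()) All.∷ All.[]) ∷ (All.[] ∷ [])))
                    (λ x∈ x∈′ → same-neighbour (ab-neighbour x∈) (ab-neighbour x∈′))
      m-subset : ∀ {S x} → x ∈ (if isEven (count S) then m v S ∷ [] else []) → x ≡ m v S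
      m-subset {S} x∈ with ∈-if⁻ (isEven (count S)) x∈
      ... | _ , here refl = refl
      unique-m : Unique (middleVertices v)
      unique-m = unique-concatMap (unique-subsetsOf (nbrs v)) (λ S → unique-if (isEven (count S)) (All.[] ∷ []))
                   (λ x∈ x∈′ → m-injective (trans (sym (m-subset x∈)) (m-subset x∈′)))
        where
          m-injective : ∀ {S S′} → m v S ≡ m v S′ → S ≡ S′
          m-injective refl = refl
      ab∉m : ∀ {x} → ¬ (x ∈ edgeVertices v × x ∈ middleVertices v)
      ab∉m (x∈ab , x∈m) with ∈-concatMap⁻′ (allFinList n) x∈ab | ∈-concatMap⁻′ (subsetsOf (nbrs v)) x∈m
      ... | _ , _ , x∈ | S , _ , x∈′ with ab-neighbour x∈ | m-subset {S} x∈′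
      ...   | inj₁ refl | ()
      ...   | inj₂ refl | ()

  unique-vertices : Unique vertices
  unique-vertices = unique-concatMap (Unique.allFin⁺ n) unique-gadget (λ x∈ x∈′ → trans (sym (owner-gadget x∈)) (owner-gadget x∈′))

  degree : Fin n → ℕ
  degree c = sum (map (λ w → indicator (adj G c w)) (allFinList n))

  length-gadget : ∀ c → length (gadget c) ≡ 2 * degree c + length (evenSubsets c)
  length-gadget c rewrite length-++ (edgeVertices c) {middleVertices c} = cong₂ _+_ length-ab length-m
    where
      length-ab : length (edgeVertices c) ≡ 2 * degree c
      length-ab = trans (length-concatMap _ (allFinList n))
                    (trans (sum-map-cong (allFinList n) (λ w → two (adj G c w))) (sum-map-* 2 (λ w → indicator (adj G c w)) (allFinList n)))
        where
          two : ∀ (t : Bool) {w} → length (if t then a c w ∷ b c w ∷ [] else []) ≡ 2 * indicator t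
          two true = refl
          two false = refl
      length-m : length (middleVertices c) ≡ length (evenSubsets c)
      length-m = trans (length-concatMap _ (subsetsOf (nbrs c)))
                   (trans (sum-map-cong (subsetsOf (nbrs c)) (λ S → one (isEven (count S))))
                          (sym (length-concatMap (λ S → if isEven (count S) then S ∷ [] else []) (subsetsOf (nbrs c)))))
        where
          one : ∀ (t : Bool) {S} → length (if t then m c S ∷ [] else []) ≡ length (if t then S ∷ [] else [])
          one true = refl
          one false = refl

  length-vertices : length vertices ≡ 2 * sum (map degree (allFinList n)) + sum (map (λ c → length (evenSubsets c)) (allFinList n))
  length-vertices = trans (length-concatMap gadget (allFinList n))
    (trans (sum-map-cong (allFinList n) length-gadget)
      (trans (sum-map-+ (λ c → 2 * degree c) (λ c → length (evenSubsets c)) (allFinList n))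
        (cong (_+ sum (map (λ c → length (evenSubsets c)) (allFinList n))) (sum-map-* 2 degree (allFinList n)))))

  record EvenSubgraph : Set where
    field
      edge       : Fin n → Fin n → Bool
      edge-sym   : ∀ v w → edge v w ≡ edge w v
      edge⊆adj   : ∀ v w → edge v w ≡ true → adj G v w ≡ true
      degree-even : ∀ v → isEven (count (tabulate (edge v))) ≡ true

  -- Flipping the CFI graph along an even subgraph T swaps a^v_e and b^v_e for e ∈ T and
  -- moves m^v_S to m^v_{S △ T(v)}; this is an automorphism of X(G) and of every twisted X(G).
  module Flip (H : EvenSubgraph) where
    open EvenSubgraph H

    _△_ : Vec Bool n → Vec Bool n → Vec Bool n
    _△_ = zipWith _xor_

    flip : XV n → XV n
    flip (a v w) = if edge v w then b v w else a v w
    flip (b v w) = if edge v w then a v w else b v w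
    flip (m v S) = m v (S △ tabulate (edge v))

    flip-involutive : ∀ x → flip (flip x) ≡ x
    flip-involutive (a v w) with edge v w in e
    ... | true rewrite e = refl
    ... | false rewrite e = refl
    flip-involutive (b v w) with edge v w in e
    ... | true rewrite e = refl
    ... | false rewrite e = refl
    flip-involutive (m v S) = cong (m v) (zipWith-xor-cancelʳ S (tabulate (edge v)))

    flip-col : ∀ x → xcol (flip x) ≡ xcol x
    flip-col (a v w) with edge v w
    ... | true = refl
    ... | false = refl
    flip-col (b v w) with edge v w
    ... | true = refl
    ... | false = refl
    flip-col (m v S) = refl

    lookup-△ : ∀ v S w → lookup (S △ tabulate (edge v)) w ≡ lookup S w xor edge v w
    lookup-△ v S w = trans (lookup-zipWith _xor_ w S (tabulate (edge v))) (cong (lookup S w xor_) (lookup∘tabulate (edge v) w))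

    △-⊆ᵇ-nbrs : ∀ v S → S ∈ subsetsOf (nbrs v) → (S △ tabulate (edge v)) ⊆ᵇ nbrs v
    △-⊆ᵇ-nbrs v S S∈ i Si rewrite lookup-△ v S i | lookup∘tabulate (adj G v) i with lookup S i in eS | edge v i in eT
    ... | true | false = trans (sym (lookup∘tabulate (adj G v) i)) (∈-subsetsOf⁻ (nbrs v) S∈ i eS)
    ... | false | true = edge⊆adj v i eT

    flip-∈ : ∀ {x} → x ∈ vertices → flip x ∈ vertices
    flip-∈ {x} x∈ = ∈-vertices⁺ (flip x) (flip-IsVertex x (∈-vertices⁻ x∈))
      where
        flip-IsVertex : ∀ x → IsVertex x → IsVertex (flip x)
        flip-IsVertex (a v w) vw with edge v w
        ... | true = vw
        ... | false = vw
        flip-IsVertex (b v w) vw with edge v w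
        ... | true = vw
        ... | false = vw
        flip-IsVertex (m v S) (S∈ , even) =
          ∈-subsetsOf⁺ _ (nbrs v) (△-⊆ᵇ-nbrs v S S∈) , even-xor S (tabulate (edge v)) even (degree-even v)

    module _ (tw : Fin n → Fin n → Bool) where

      private
        E : XV n → XV n → Bool
        E = edgeTw tw

      edgeTw-m-comm : ∀ x v S → E x (m v S) ≡ E (m v S) x
      edgeTw-m-comm (a _ _) v S = refl
      edgeTw-m-comm (b _ _) v S = refl
      edgeTw-m-comm (m _ _) v S = refl

      flip-edge-m-a : ∀ v S v′ w → E (flip (m v S)) (flip (a v′ w)) ≡ E (m v S) (a v′ w)
      flip-edge-m-a v S v′ w with edge v′ w in eT
      ... | true with v == v′ in ev
      ...   | false = refl
      ...   | true with refl ← ==⇒≡ v v′ ev rewrite lookup-△ v S w | eT = cong (adj G v w ∧_) (not-xor-true (lookup S w))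
      flip-edge-m-a v S v′ w | false with v == v′ in ev
      ...   | false = refl
      ...   | true with refl ← ==⇒≡ v v′ ev rewrite lookup-△ v S w | eT = cong (adj G v w ∧_) (xor-identityʳ (lookup S w))

      flip-edge-m-b : ∀ v S v′ w → E (flip (m v S)) (flip (b v′ w)) ≡ E (m v S) (b v′ w)
      flip-edge-m-b v S v′ w with edge v′ w in eT
      ... | true with v == v′ in ev
      ...   | false = refl
      ...   | true with refl ← ==⇒≡ v v′ ev rewrite lookup-△ v S w | eT = cong (adj G v w ∧_) (xor-true (lookup S w))
      flip-edge-m-b v S v′ w | false with v == v′ in ev
      ...   | false = refl
      ...   | true with refl ← ==⇒≡ v v′ ev rewrite lookup-△ v S w | eT = cong (λ t → adj G v w ∧ not t) (xor-identityʳ (lookup S w))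

      -- A connecting edge between the gadgets of u and w is matched only by its own partner,
      -- and both of its ends are flipped alike since T is symmetric.
      connecting-guard : ∀ {u w w′ u′} (X Y : Bool) → edge u w ≢ edge w′ u′ →
                         adj G u w ∧ (w == w′) ∧ (u == u′) ∧ X ≡ adj G u w ∧ (w == w′) ∧ (u == u′) ∧ Y
      connecting-guard {u} {w} {w′} {u′} X Y T≢ with w == w′ in ew | u == u′ in eu
      ... | false | _ = refl
      ... | true | false = refl
      ... | true | true with refl ← ==⇒≡ w w′ ew | refl ← ==⇒≡ u u′ eu = ⊥-elim (T≢ (edge-sym u w))

      flip-edge : ∀ x y → E (flip x) (flip y) ≡ E x y
      flip-edge (m v S) (m v′ S′) = refl
      flip-edge (m v S) (a v′ w) = flip-edge-m-a v S v′ w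
      flip-edge (m v S) (b v′ w) = flip-edge-m-b v S v′ w
      flip-edge (a v′ w) (m v S) = trans (edgeTw-m-comm (flip (a v′ w)) v _) (flip-edge-m-a v S v′ w)
      flip-edge (b v′ w) (m v S) = trans (edgeTw-m-comm (flip (b v′ w)) v _) (flip-edge-m-b v S v′ w)
      flip-edge (a u w) (a w′ u′) with edge u w in e₁ | edge w′ u′ in e₂
      ... | true | true = refl
      ... | false | false = refl
      ... | true | false = connecting-guard (tw u w) (not (tw u w)) (≢-true-false e₁ e₂)
      ... | false | true = connecting-guard (tw u w) (not (tw u w)) (≢-true-false e₂ e₁ ∘′ sym)
      flip-edge (b u w) (b w′ u′) with edge u w in e₁ | edge w′ u′ in e₂
      ... | true | true = refl
      ... | false | false = refl
      ... | true | false = connecting-guard (tw u w) (not (tw u w)) (≢-true-false e₁ e₂)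
      ... | false | true = connecting-guard (tw u w) (not (tw u w)) (≢-true-false e₂ e₁ ∘′ sym)
      flip-edge (a u w) (b w′ u′) with edge u w in e₁ | edge w′ u′ in e₂
      ... | true | true = refl
      ... | false | false = refl
      ... | true | false = connecting-guard (not (tw u w)) (tw u w) (≢-true-false e₁ e₂)
      ... | false | true = connecting-guard (not (tw u w)) (tw u w) (≢-true-false e₂ e₁ ∘′ sym)
      flip-edge (b u w) (a w′ u′) with edge u w in e₁ | edge w′ u′ in e₂
      ... | true | true = refl
      ... | false | false = refl
      ... | true | false = connecting-guard (not (tw u w)) (tw u w) (≢-true-false e₁ e₂)
      ... | false | true = connecting-guard (not (tw u w)) (tw u w) (≢-true-false e₂ e₁ ∘′ sym)

    module _ (u₀ v₀ : Fin n) where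
      open IsoFormulaProperties (_≟XV_ {n}) _≟XC_ xcol
      open SecondCoordinateSymmetry vertices vertices edgeX (edgeX̃ u₀ v₀) flip flip-involutive flip-∈ flip-col (flip-edge _) public
        using () renaming (ψ-renaming to flip-renaming; mapsInto to flip-mapsInto)

-- A breadth-first spanning tree of the component of a vertex

anyᶠ : ∀ {n} → (Fin n → Bool) → Bool
anyᶠ {zero} f = false
anyᶠ {suc n} f = f zero ∨ anyᶠ (λ i → f (suc i))

anyᶠ⁻ : ∀ {n} (f : Fin n → Bool) → anyᶠ f ≡ true → ∃ λ i → f i ≡ true
anyᶠ⁻ {suc n} f eq with f zero in f0
... | true = zero , f0
... | false with anyᶠ⁻ (λ i → f (suc i)) eq
...   | i , fi = suc i , fi

anyᶠ⁺ : ∀ {n} (f : Fin n → Bool) (i : Fin n) → f i ≡ true → anyᶠ f ≡ true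
anyᶠ⁺ f zero fi rewrite fi = refl
anyᶠ⁺ {suc n} f (suc i) fi rewrite anyᶠ⁺ (λ j → f (suc j)) i fi = ∨-zeroʳ (f zero)

-- The least k ≤ N with f k, or N if there is none.
least : (ℕ → Bool) → ℕ → ℕ
least f zero = 0
least f (suc N) = if f 0 then 0 else suc (least (λ k → f (suc k)) N)

least-satisfies : ∀ (f : ℕ → Bool) N → f N ≡ true → f (least f N) ≡ true
least-satisfies f zero fN = fN
least-satisfies f (suc N) fN with f 0 in f0
... | true = f0
... | false = least-satisfies (λ k → f (suc k)) N fN

least-minimal : ∀ (f : ℕ → Bool) N j → j < least f N → f j ≡ false
least-minimal f (suc N) j j< with f 0 in f0
least-minimal f (suc N) zero j< | false = f0
least-minimal f (suc N) (suc j) (s≤s j<) | false = least-minimal (λ k → f (suc k)) N j j<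

least-≤ : ∀ (f : ℕ → Bool) N j → f j ≡ true → j ≤ N → least f N ≤ j
least-≤ f zero j _ _ = z≤n
least-≤ f (suc N) j fj j≤ with f 0 in f0
... | true = z≤n
least-≤ f (suc N) zero fj j≤ | false with () ← trans (sym fj) f0
least-≤ f (suc N) (suc j) fj (s≤s j≤) | false = s≤s (least-≤ (λ k → f (suc k)) N j fj j≤)

least-≤-bound : ∀ (f : ℕ → Bool) N → least f N ≤ N
least-≤-bound f zero = z≤n
least-≤-bound f (suc N) with f 0
... | true = z≤n
... | false = s≤s (least-≤-bound (λ k → f (suc k)) N)

firstOr : {A : Set} → (A → Bool) → A → List A → A
firstOr f d [] = d
firstOr f d (x ∷ xs) = if f x then x else firstOr f d xs

firstOr-satisfies : {A : Set} (f : A → Bool) (d : A) (xs : List A) {x : A} → x ∈ xs → f x ≡ true →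
                    f (firstOr f d xs) ≡ true
firstOr-satisfies f d (y ∷ xs) x∈ fx with f y in fy
... | true = fy
firstOr-satisfies f d (y ∷ xs) (here refl) fx | false with () ← trans (sym fx) fy
firstOr-satisfies f d (y ∷ xs) (there x∈) fx | false = firstOr-satisfies f d xs x∈ fx

module SpanningTree {n : ℕ} (G : SimpleGraph n) (root : Fin n) where

  reach : ℕ → Fin n → Bool
  reach zero c = c == root
  reach (suc k) c = reach k c ∨ anyᶠ (λ w → adj G c w ∧ reach k w)

  reach-suc : ∀ {k c} → reach k c ≡ true → reach (suc k) c ≡ true
  reach-suc eq rewrite eq = refl

  reach-mono : ∀ {k k′} c → k ≤ k′ → reach k c ≡ true → reach k′ c ≡ true
  reach-mono {k} {zero} c z≤n eq = eq
  reach-mono {k} {suc k′} c k≤ eq with m≤n⇒m<n∨m≡n k≤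
  ... | inj₁ (s≤s k<) = reach-suc {k′} {c} (reach-mono c k< eq)
  ... | inj₂ refl = eq

  reach-step : ∀ {k c w} → adj G c w ≡ true → reach k w ≡ true → reach (suc k) c ≡ true
  reach-step {k} {c} {w} cw rw with reach k c
  ... | true = refl
  ... | false = anyᶠ⁺ (λ x → adj G c x ∧ reach k x) w (∧-true⁺ cw rw)

  reach-suc⁻ : ∀ {k c} → reach (suc k) c ≡ true → reach k c ≡ true ⊎ ∃ λ w → adj G c w ≡ true × reach k w ≡ true
  reach-suc⁻ {k} {c} eq with ∨-true⁻ {reach k c} eq
  ... | inj₁ rc = inj₁ rc
  ... | inj₂ any with anyᶠ⁻ _ any
  ...   | w , cw = inj₂ (w , ∧-true⁻ cw)

  InComponent : Fin n → Set
  InComponent c = reach n c ≡ true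

  depth : Fin n → ℕ
  depth c = least (λ k → reach k c) n

  reach-depth : ∀ {c} → InComponent c → reach (depth c) c ≡ true
  reach-depth {c} = least-satisfies (λ k → reach k c) n

  reach-<depth : ∀ {c} j → j < depth c → reach j c ≡ false
  reach-<depth {c} = least-minimal (λ k → reach k c) n

  depth-minimal : ∀ {c} j → reach j c ≡ true → j ≤ n → depth c ≤ j
  depth-minimal {c} = least-≤ (λ k → reach k c) n

  depth≤n : ∀ c → depth c ≤ n
  depth≤n c = least-≤-bound (λ k → reach k c) n

  parentVia : ℕ → Fin n → Fin n
  parentVia zero c = c
  parentVia (suc k) c = firstOr (λ w → adj G c w ∧ reach k w) c (allFinList n)

  parent : Fin n → Fin n
  parent c = parentVia (depth c) c

  depth≡0⇒root : ∀ {c} → InComponent c → depth c ≡ 0 → c ≡ root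
  depth≡0⇒root {c} c∈ eq = ==⇒≡ c root (subst (λ k → reach k c ≡ true) eq (reach-depth c∈))

  parent-adj : ∀ {c k} → InComponent c → depth c ≡ suc k → adj G c (parent c) ≡ true × reach k (parent c) ≡ true
  parent-adj {c} {k} c∈ eq with reach-suc⁻ {k} {c} (subst (λ j → reach j c ≡ true) eq (reach-depth c∈))
  ... | inj₁ rc with () ← trans (sym rc) (reach-<depth k (subst (k <_) (sym eq) ≤-refl))
  ... | inj₂ (w , cw , rw) rewrite eq =
    ∧-true⁻ (firstOr-satisfies (λ x → adj G c x ∧ reach k x) c (allFinList n) (∈-allFin w) (∧-true⁺ cw rw))

  private
    depth-pred≤n : ∀ {c k} → depth c ≡ suc k → k ≤ n
    depth-pred≤n {c} eq = ≤-trans (n≤1+n _) (subst (_≤ n) eq (depth≤n c))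

  parent-inComponent : ∀ {c k} → InComponent c → depth c ≡ suc k → InComponent (parent c)
  parent-inComponent {c} c∈ eq = reach-mono (parent c) (depth-pred≤n {c} eq) (proj₂ (parent-adj c∈ eq))

  depth-parent : ∀ {c k} → InComponent c → depth c ≡ suc k → depth (parent c) ≡ k
  depth-parent {c} {k} c∈ eq = ≤-antisym (depth-minimal k (proj₂ (parent-adj c∈ eq)) (depth-pred≤n {c} eq)) (≮⇒≥ deeper)
    where
      deeper : ¬ depth (parent c) < k
      deeper d< with () ← trans (sym (reach-step {depth (parent c)} (proj₁ (parent-adj c∈ eq)) (reach-depth (parent-inComponent c∈ eq))))
                                (reach-<depth (suc (depth (parent c))) (subst (suc (depth (parent c)) <_) (sym eq) (s≤s d<)))

  Stable : ℕ → Set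
  Stable k = ∀ w → reach (suc k) w ≡ true → reach k w ≡ true

  stable-suc : ∀ {k} → Stable k → Stable (suc k)
  stable-suc {k} st w eq with reach-suc⁻ {suc k} {w} eq
  ... | inj₁ rw = rw
  ... | inj₂ (x , wx , rx) = reach-step {k} wx (st x rx)

  stable-mono : ∀ {j} k → j ≤ k → Stable j → Stable k
  stable-mono {j} k j≤ st with m≤n⇒m<n∨m≡n j≤
  ... | inj₂ refl = st
  stable-mono {j} (suc k) j≤ st | inj₁ (s≤s j<) = stable-suc {k} (stable-mono k j< st)

  -- Until the reachable sets stabilise, each step adds a vertex.
  stable-or-grows : ∀ k → (∃ λ j → j ≤ k × Stable j) ⊎ (k < count (tabulate (reach k)))
  stable-or-grows zero = inj₂ (count-pos (tabulate (reach zero)) root (trans (lookup∘tabulate (reach 0) root) (==-refl root)))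
  stable-or-grows (suc k) with stable-or-grows k
  ... | inj₁ (j , j≤ , st) = inj₁ (j , m≤n⇒m≤1+n j≤ , st)
  ... | inj₂ k< with any? (λ w → (reach (suc k) w ∧ not (reach k w)) ≟ᵇ true)
  ...   | yes (w , new) = inj₂ (≤-trans (s≤s k<)
          (count-strict (tabulate (reach k)) (tabulate (reach (suc k)))
            (λ i eq → trans (lookup∘tabulate (reach (suc k)) i) (reach-suc {k} {i} (trans (sym (lookup∘tabulate (reach k) i)) eq))) w
            (trans (lookup∘tabulate (reach k) w) (not-true⁻ (proj₂ (∧-true⁻ new))))
            (trans (lookup∘tabulate (reach (suc k)) w) (proj₁ (∧-true⁻ new)))))
  ...   | no nothing-new = inj₁ (k , n≤1+n k , old)
    where
      old : Stable k
      old w eq with reach k w in rw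
      ... | true = refl
      ... | false = ⊥-elim (nothing-new (w , ∧-true⁺ eq′ (cong not rw)))
        where eq′ = subst (λ z → (z ∨ anyᶠ (λ x → adj G w x ∧ reach k x)) ≡ true) (sym rw) eq

  stable-n : Stable n
  stable-n with stable-or-grows n
  ... | inj₁ (j , j≤ , st) = stable-mono n j≤ st
  ... | inj₂ n< = ⊥-elim (<-irrefl refl (≤-trans n< (count≤length (tabulate (reach n)))))

  inComponent-adj : ∀ {c w} → InComponent c → adj G c w ≡ true → InComponent w
  inComponent-adj {c} {w} c∈ cw = stable-n w (reach-step {n} (trans (SimpleGraph.sym G w c) cw) c∈)

  ancestor : ℕ → Fin n → Fin n
  ancestor zero c = c
  ancestor (suc k) c = ancestor k (parent c)

  pathUp : ℕ → Fin n → List (Fin n × Fin n)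
  pathUp zero c = []
  pathUp (suc k) c = (c , parent c) ∷ pathUp k (parent c)

  ancestor-depth : ∀ k {c} → InComponent c → depth c ≡ k → ancestor k c ≡ root
  ancestor-depth zero c∈ eq = depth≡0⇒root c∈ eq
  ancestor-depth (suc k) c∈ eq = ancestor-depth k (parent-inComponent c∈ eq) (depth-parent c∈ eq)

  pathUp-steps : ∀ k {c} → InComponent c → depth c ≡ k → ∀ {s} → s ∈ pathUp k c →
                 adj G (proj₁ s) (proj₂ s) ≡ true × proj₂ s ≡ parent (proj₁ s)
  pathUp-steps (suc k) c∈ eq (here refl) = proj₁ (parent-adj c∈ eq) , refl
  pathUp-steps (suc k) c∈ eq (there s∈) = pathUp-steps k (parent-inComponent c∈ eq) (depth-parent c∈ eq) s∈

-- Walks and the parity of their edge multiplicities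

tabulate-xor : ∀ {k} (f g : Fin k → Bool) → tabulate (λ i → f i xor g i) ≡ zipWith _xor_ (tabulate f) (tabulate g)
tabulate-xor {zero} f g = refl
tabulate-xor {suc k} f g = cong ((f zero xor g zero) ∷_) (tabulate-xor (λ i → f (suc i)) (λ i → g (suc i)))

count-tabulate-false : ∀ k → count (tabulate {n = k} (λ _ → false)) ≡ 0
count-tabulate-false zero = refl
count-tabulate-false (suc k) = count-tabulate-false k

count-tabulate-== : ∀ {k} (t : Fin k) → count (tabulate (t ==_)) ≡ 1
count-tabulate-== {suc k} zero = cong suc (count-tabulate-false k)
count-tabulate-== (suc t) = count-tabulate-== t

isEven-count-point : ∀ {k} c (t : Fin k) → isEven (count (tabulate (λ w → c ∧ (t == w)))) ≡ not c
isEven-count-point {k} true t = cong isEven (count-tabulate-== t)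
isEven-count-point {k} false t = cong isEven (count-tabulate-false k)

module Walks {n : ℕ} where

  Walk : Set
  Walk = List (Fin n × Fin n)

  oddTraversals : Walk → Fin n → Fin n → Bool
  oddTraversals [] v w = false
  oddTraversals ((s , t) ∷ ss) v w = (((s == v) ∧ (t == w)) xor ((s == w) ∧ (t == v))) xor oddTraversals ss v w

  oddEndpoints : Walk → Fin n → Bool
  oddEndpoints [] v = false
  oddEndpoints ((s , t) ∷ ss) v = ((s == v) xor (t == v)) xor oddEndpoints ss v

  -- The handshake lemma, mod 2.
  isEven-degree : ∀ ss v → isEven (count (tabulate (oddTraversals ss v))) ≡ not (oddEndpoints ss v)
  isEven-degree [] v = cong isEven (count-tabulate-false n)
  isEven-degree ((s , t) ∷ ss) v = begin
    isEven (count (tabulate (λ w → (P w xor Q w) xor R w)))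
      ≡⟨ cong (λ S → isEven (count S)) (tabulate-xor (λ w → P w xor Q w) R) ⟩
    isEven (count (zipWith _xor_ (tabulate (λ w → P w xor Q w)) (tabulate R)))
      ≡⟨ isEven-count-xor (tabulate (λ w → P w xor Q w)) (tabulate R) ⟩
    not (isEven (count (tabulate (λ w → P w xor Q w))) xor isEven (count (tabulate R)))
      ≡⟨ cong₂ (λ x y → not (x xor y)) PQ-even (isEven-degree ss v) ⟩
    not (not ((s == v) xor (t == v)) xor not (oddEndpoints ss v))
      ≡⟨ cong not (xor-annihilates-not ((s == v) xor (t == v)) (oddEndpoints ss v)) ⟩
    not (((s == v) xor (t == v)) xor oddEndpoints ss v) ∎
    where
      open ≡-Reasoning
      P Q R : Fin n → Bool
      P w = (s == v) ∧ (t == w)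
      Q w = (s == w) ∧ (t == v)
      R = oddTraversals ss v
      PQ-even : isEven (count (tabulate (λ w → P w xor Q w))) ≡ not ((s == v) xor (t == v))
      PQ-even = begin
        isEven (count (tabulate (λ w → P w xor Q w)))
          ≡⟨ cong (λ S → isEven (count S)) (tabulate-xor P Q) ⟩
        isEven (count (zipWith _xor_ (tabulate P) (tabulate Q)))
          ≡⟨ isEven-count-xor (tabulate P) (tabulate Q) ⟩
        not (isEven (count (tabulate P)) xor isEven (count (tabulate Q)))
          ≡⟨ cong₂ (λ x y → not (x xor y)) (isEven-count-point (s == v) t)
                (trans (cong (λ S → isEven (count S)) (Vec.tabulate-cong (λ w → ∧-comm (s == w) (t == v))))
                       (isEven-count-point (t == v) s)) ⟩
        not (not (s == v) xor not (t == v))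
          ≡⟨ cong not (xor-annihilates-not (s == v) (t == v)) ⟩
        not ((s == v) xor (t == v)) ∎

  oddTraversals-++ : ∀ xs ys v w → oddTraversals (xs ++ ys) v w ≡ oddTraversals xs v w xor oddTraversals ys v w
  oddTraversals-++ [] ys v w = refl
  oddTraversals-++ ((s , t) ∷ xs) ys v w rewrite oddTraversals-++ xs ys v w =
    sym (xor-assoc (((s == v) ∧ (t == w)) xor ((s == w) ∧ (t == v))) (oddTraversals xs v w) (oddTraversals ys v w))

  oddEndpoints-++ : ∀ xs ys v → oddEndpoints (xs ++ ys) v ≡ oddEndpoints xs v xor oddEndpoints ys v
  oddEndpoints-++ [] ys v = refl
  oddEndpoints-++ ((s , t) ∷ xs) ys v rewrite oddEndpoints-++ xs ys v =
    sym (xor-assoc ((s == v) xor (t == v)) (oddEndpoints xs v) (oddEndpoints ys v))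

  oddTraversals-sym : ∀ ss v w → oddTraversals ss v w ≡ oddTraversals ss w v
  oddTraversals-sym [] v w = refl
  oddTraversals-sym ((s , t) ∷ ss) v w = cong₂ _xor_ (xor-comm ((s == v) ∧ (t == w)) _) (oddTraversals-sym ss v w)

  private
    no-step : ∀ {s t v w : Fin n} → (s ≡ v → t ≡ w → ⊥) → ((s == v) ∧ (t == w)) ≡ false
    no-step {s} {t} {v} {w} ¬st with s == v in sv
    ... | false = refl
    ... | true with t == w in tw
    ...   | false = refl
    ...   | true = ⊥-elim (¬st (==⇒≡ s v sv) (==⇒≡ t w tw))

  untraversed : ∀ ss v w → (∀ {s} → s ∈ ss → (proj₁ s ≡ v → proj₂ s ≡ w → ⊥) × (proj₁ s ≡ w → proj₂ s ≡ v → ⊥)) →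
                oddTraversals ss v w ≡ false
  untraversed [] v w _ = refl
  untraversed ((s , t) ∷ ss) v w avoids
    rewrite no-step {s} {t} {v} {w} (proj₁ (avoids (here refl))) | no-step {s} {t} {w} {v} (proj₂ (avoids (here refl))) =
    untraversed ss v w (λ s∈ → avoids (there s∈))

-- Non-tree edges and their fundamental cycles

module Cycles {n : ℕ} (G : SimpleGraph n) (root : Fin n) where
  open SpanningTree G root public
  open Walks {n} public
  open CFIProperties G using (EvenSubgraph)

  nonTree : Fin n → Fin n → Bool
  nonTree x y = adj G x y ∧ reach n x ∧ reach n y ∧ not (parent x == y) ∧ not (parent y == x)

  record NonTreeEdge (x y : Fin n) : Set where
    field
      adjacent   : adj G x y ≡ true
      x∈         : InComponent x
      y∈         : InComponent y
      parent-x≢y : parent x ≢ y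
      parent-y≢x : parent y ≢ x

  nonTree⇒NonTreeEdge : ∀ {x y} → nonTree x y ≡ true → NonTreeEdge x y
  nonTree⇒NonTreeEdge {x} {y} eq with ∧-true⁻ {adj G x y} eq
  ... | xy , eq₁ with ∧-true⁻ {reach n x} eq₁
  ...   | x∈ , eq₂ with ∧-true⁻ {reach n y} eq₂
  ...     | y∈ , eq₃ with ∧-true⁻ {not (parent x == y)} eq₃
  ...       | px , py = record
    { adjacent = xy ; x∈ = x∈ ; y∈ = y∈
    ; parent-x≢y = λ { refl → ≢-true-false (==-refl (parent x)) (not-true⁻ px) refl }
    ; parent-y≢x = λ { refl → ≢-true-false (==-refl (parent y)) (not-true⁻ py) refl } }

  NonTreeEdge⇒nonTree : ∀ {x y} → NonTreeEdge x y → nonTree x y ≡ true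
  NonTreeEdge⇒nonTree e = ∧-true⁺ adjacent (∧-true⁺ x∈ (∧-true⁺ y∈
    (∧-true⁺ (cong not (≢⇒==false parent-x≢y)) (cong not (≢⇒==false parent-y≢x)))))
    where open NonTreeEdge e

  NonTreeEdge-sym : ∀ {x y} → NonTreeEdge x y → NonTreeEdge y x
  NonTreeEdge-sym {x} {y} e = record
    { adjacent = trans (SimpleGraph.sym G y x) adjacent ; x∈ = y∈ ; y∈ = x∈
    ; parent-x≢y = parent-y≢x ; parent-y≢x = parent-x≢y }
    where open NonTreeEdge e

  pathToRoot : Fin n → Walk
  pathToRoot z = pathUp (depth z) z

  cycle : Fin n → Fin n → Walk
  cycle x y = pathToRoot x ++ pathToRoot y ++ (y , x) ∷ []

  pathToRoot-steps : ∀ {z} → InComponent z → ∀ {s} → s ∈ pathToRoot z →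
                     adj G (proj₁ s) (proj₂ s) ≡ true × proj₂ s ≡ parent (proj₁ s)
  pathToRoot-steps {z} z∈ = pathUp-steps (depth z) z∈ refl

  oddEndpoints-pathUp : ∀ k c v → oddEndpoints (pathUp k c) v ≡ (c == v) xor (ancestor k c == v)
  oddEndpoints-pathUp zero c v = sym (xor-same (c == v))
  oddEndpoints-pathUp (suc k) c v rewrite oddEndpoints-pathUp k (parent c) v =
    trans (xor-assoc (c == v) (parent c == v) _)
          (cong ((c == v) xor_) (trans (sym (xor-assoc (parent c == v) (parent c == v) _))
                                       (cong (_xor (ancestor k (parent c) == v)) (xor-same (parent c == v)))))

  oddEndpoints-pathToRoot : ∀ {z} v → InComponent z → oddEndpoints (pathToRoot z) v ≡ (z == v) xor (root == v)
  oddEndpoints-pathToRoot {z} v z∈ =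
    trans (oddEndpoints-pathUp (depth z) z v) (cong (λ r → (z == v) xor (r == v)) (ancestor-depth (depth z) z∈ refl))

  pathToRoot-untraversed : ∀ {x y z} → NonTreeEdge x y → InComponent z → oddTraversals (pathToRoot z) x y ≡ false
  pathToRoot-untraversed e z∈ = untraversed _ _ _ λ s∈ →
      (λ { refl refl → NonTreeEdge.parent-x≢y e (sym (proj₂ (pathToRoot-steps z∈ s∈))) })
    , (λ { refl refl → NonTreeEdge.parent-y≢x e (sym (proj₂ (pathToRoot-steps z∈ s∈))) })

  module FundamentalCycle {x y : Fin n} (e : NonTreeEdge x y) where
    open NonTreeEdge e

    cycle-steps : ∀ {s} → s ∈ cycle x y → adj G (proj₁ s) (proj₂ s) ≡ true
    cycle-steps s∈ with ∈-++⁻ (pathToRoot x) s∈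
    ... | inj₁ s∈x = proj₁ (pathToRoot-steps x∈ s∈x)
    ... | inj₂ s∈′ with ∈-++⁻ (pathToRoot y) s∈′
    ...   | inj₁ s∈y = proj₁ (pathToRoot-steps y∈ s∈y)
    ...   | inj₂ (here refl) = trans (SimpleGraph.sym G y x) adjacent

    cycle⊆adj : ∀ v w → oddTraversals (cycle x y) v w ≡ true → adj G v w ≡ true
    cycle⊆adj v w odd with adj G v w in vw
    ... | true = refl
    ... | false = ⊥-elim (≢-true-false odd (untraversed (cycle x y) v w λ s∈ →
            (λ { refl refl → ≢-true-false (cycle-steps s∈) vw refl })
          , (λ { refl refl → ≢-true-false (cycle-steps s∈) (trans (SimpleGraph.sym G w v) vw) refl })) refl)

    cycle-degree-even : ∀ v → isEven (count (tabulate (oddTraversals (cycle x y) v))) ≡ true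
    cycle-degree-even v = trans (isEven-degree (cycle x y) v) (cong not endpoints)
      where
        closed : ∀ p q r → (p xor r) xor ((q xor r) xor ((q xor p) xor false)) ≡ false
        closed true true true = refl
        closed true true false = refl
        closed true false true = refl
        closed true false false = refl
        closed false true true = refl
        closed false true false = refl
        closed false false true = refl
        closed false false false = refl
        endpoints : oddEndpoints (cycle x y) v ≡ false
        endpoints rewrite oddEndpoints-++ (pathToRoot x) (pathToRoot y ++ (y , x) ∷ []) v
                        | oddEndpoints-++ (pathToRoot y) ((y , x) ∷ []) v
                        | oddEndpoints-pathToRoot v x∈ | oddEndpoints-pathToRoot v y∈ = closed (x == v) (y == v) (root == v)

    cycleSubgraph : EvenSubgraph
    cycleSubgraph = record
      { edge = oddTraversals (cycle x y) ; edge-sym = oddTraversals-sym (cycle x y)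
      ; edge⊆adj = cycle⊆adj ; degree-even = cycle-degree-even }

    cycle-nonTree : ∀ {x′ y′} → NonTreeEdge x′ y′ → oddTraversals (cycle x y) x′ y′ ≡ oddTraversals ((y , x) ∷ []) x′ y′
    cycle-nonTree {x′} {y′} e′
      rewrite oddTraversals-++ (pathToRoot x) (pathToRoot y ++ (y , x) ∷ []) x′ y′
            | oddTraversals-++ (pathToRoot y) ((y , x) ∷ []) x′ y′
            | pathToRoot-untraversed {z = x} e′ x∈ | pathToRoot-untraversed {z = y} e′ y∈ = refl

    cycle-own-edge : oddTraversals (cycle x y) x y ≡ true
    cycle-own-edge rewrite cycle-nonTree e | ==-refl x | ==-refl y
                         | ≢⇒==false {u = y} {v = x} (λ { refl → ≢-true-false adjacent (SimpleGraph.irrefl G x) refl }) = refl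

    cycle-other-edge : ∀ {x′ y′} → NonTreeEdge x′ y′ → toℕ x < toℕ y → toℕ x′ < toℕ y′ → (x′ ≡ x → y′ ≡ y → ⊥) →
                       oddTraversals (cycle x y) x′ y′ ≡ false
    cycle-other-edge {x′} {y′} e′ x<y x′<y′ ≢xy rewrite cycle-nonTree e′ =
      untraversed ((y , x) ∷ []) x′ y′ λ { (here refl) → (λ { refl refl → <-asym x<y x′<y′ }) , (λ { refl refl → ≢xy refl refl }) }

-- The refutation of F(X(G), X̃(G))

module Refutation {n : ℕ} (G : SimpleGraph n) (u₀ v₀ : Fin n) (u₀v₀ : adj G u₀ v₀ ≡ true) where
  open CFIProperties G
  open Cycles G u₀
  open IsoFormulaProperties (_≟XV_ {n}) _≟XC_ xcol using (type1Clause; type3Condition; ≡⇒compatible)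
  module Iso = IsoFormulaProperties (_≟XV_ {n}) _≟XC_ xcol

  Var : Set
  Var = XV n × XV n

  _≟V_ : DecidableEquality Var
  _≟V_ = Product.≡-dec _≟XV_ _≟XV_

  -- F and its type-1 clauses are opaque so that type checking never unfolds the concrete formula.
  opaque
    F : Formula Var
    F = F-CFI u₀ v₀

    F≡F-CFI : F ≡ F-CFI u₀ v₀
    F≡F-CFI = refl

  open Derivations _≟V_ F
  open import Data.List.Membership.DecPropositional (_≟ˡ_ _≟V_) using () renaming (_∈?_ to _∈ˡ?_)

  E₁ E₂ : XV n → XV n → Bool
  E₁ = edgeX
  E₂ = edgeX̃ u₀ v₀

  opaque
    clause₁ : XV n → Clause Var
    clause₁ = type1Clause vertices

  opaque
    unfolding F clause₁

    clause₁∈F : ∀ {p} → p ∈ vertices → clause₁ p ∈ F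
    clause₁∈F = Iso.type1∈ vertices vertices E₁ E₂

    clause₃∈F : ∀ {u₁ v₁ u₂ v₂} → u₁ ∈ vertices → v₁ ∈ vertices → u₂ ∈ vertices → v₂ ∈ vertices →
                type3Condition E₁ E₂ u₁ v₁ u₂ v₂ ≡ true → (neg (u₁ , u₂) ∷ neg (v₁ , v₂) ∷ []) ∈ F
    clause₃∈F = Iso.type3∈ vertices vertices E₁ E₂

  opaque
    unfolding clause₁

    ∈-clause₁⁻ : ∀ {p ℓ} → ℓ ∈ clause₁ p → ∃ λ q → ℓ ≡ pos (p , q) × q ∈ vertices × xcol p ≡ xcol q
    ∈-clause₁⁻ = Iso.∈-type1Clause⁻

    ∈-clause₁⁺ : ∀ {p q} → q ∈ vertices → xcol p ≡ xcol q → pos (p , q) ∈ clause₁ p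
    ∈-clause₁⁺ = Iso.∈-type1Clause⁺

  -- The literals ¬x_{a^x_y , a^x_y} of the non-tree edges, oriented by x < y: they are assumed
  -- during the main derivation and discharged at the end by the cycle symmetries.
  Assumption : Lit Var → Set
  Assumption ℓ = ∃ λ x → ∃ λ y → NonTreeEdge x y × toℕ x < toℕ y × ℓ ≡ neg (a x y , a x y)

  Known : Context → Lit Var → Set
  Known Γ t = ∃ λ X → X ∈ Γ × t ∈ X × (∀ {ℓ} → ℓ ∈ X → ℓ ≡ t ⊎ Assumption ℓ)

  known-mono : ∀ {Γ Γ′ t} → Γ ⊆ Γ′ → Known Γ t → Known Γ′ t
  known-mono Γ⊆ (X , X∈ , t∈ , lits) = X , Γ⊆ X∈ , t∈ , lits

  Base : Context → Set
  Base Γ = F ⊆ Γ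

  known-by-clause : ∀ {Γ P C t} → Known Γ (neg P) → C ∈ Γ → pos P ∈ C → t ∈ C → t ≢ pos P →
                    (∀ {ℓ} → ℓ ∈ C → ℓ ≢ pos P → ℓ ≡ t) → Derivation Γ (λ Γ′ → Known Γ′ t) 1
  known-by-clause {P = P} {C} {t} (X , X∈ , P̄∈ , lits) C∈ P∈ t∈ t≢ C-lits =
    post-map (λ _ _ R∈ → resolve C X P , R∈ , ∈-resolve⁺ {C} {X} {P} (inj₁ (t∈ , t≢)) , R-lits) (resolveStep C∈ X∈ P∈ P̄∈)
    where
      R-lits : ∀ {ℓ} → ℓ ∈ resolve C X P → ℓ ≡ t ⊎ Assumption ℓ
      R-lits ℓ∈ with ∈-resolve⁻ {C} {X} {P} ℓ∈
      ... | inj₁ (ℓ∈C , ℓ≢) = inj₁ (C-lits ℓ∈C ℓ≢)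
      ... | inj₂ (ℓ∈X , ℓ≢) with lits ℓ∈X
      ...   | inj₁ ℓ≡ = ⊥-elim (ℓ≢ ℓ≡)
      ...   | inj₂ as = inj₂ as

  known-by-binary : ∀ {Γ P t} → Known Γ (pos P) → (neg P ∷ t ∷ []) ∈ Γ → t ≢ neg P → Derivation Γ (λ Γ′ → Known Γ′ t) 1
  known-by-binary {P = P} {t} (X , X∈ , P∈ , lits) K∈ t≢ =
    post-map (λ _ _ R∈ → resolve X K P , R∈ , ∈-resolve⁺ {X} {K} {P} (inj₂ (there (here refl) , t≢)) , R-lits)
      (resolveStep X∈ K∈ P∈ (here refl))
    where
      K = neg P ∷ t ∷ []
      R-lits : ∀ {ℓ} → ℓ ∈ resolve X K P → ℓ ≡ t ⊎ Assumption ℓ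
      R-lits ℓ∈ with ∈-resolve⁻ {X} {K} {P} ℓ∈
      ... | inj₁ (ℓ∈X , ℓ≢) with lits ℓ∈X
      ...   | inj₁ ℓ≡ = ⊥-elim (ℓ≢ ℓ≡)
      ...   | inj₂ as = inj₂ as
      R-lits ℓ∈ | inj₂ (here ℓ≡ , ℓ≢) = ⊥-elim (ℓ≢ ℓ≡)
      R-lits ℓ∈ | inj₂ (there (here ℓ≡) , _) = inj₁ ℓ≡

  -- The type-1 clause of a^c_w is x_{a^c_w, a^c_w} ∨ x_{a^c_w, b^c_w}.
  known-aa : ∀ {Γ c w} → adj G c w ≡ true → Base Γ → Known Γ (neg (a c w , b c w)) →
             Derivation Γ (λ Γ′ → Known Γ′ (pos (a c w , a c w))) 1
  known-aa cw base k =
    known-by-clause k (base (clause₁∈F (a∈vertices cw))) (∈-clause₁⁺ (b∈vertices cw) refl) (∈-clause₁⁺ (a∈vertices cw) refl)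
      (λ ()) only-aa
    where
      only-aa : ∀ {c w ℓ} → ℓ ∈ clause₁ (a c w) → ℓ ≢ pos (a c w , b c w) → ℓ ≡ pos (a c w , a c w)
      only-aa ℓ∈ ℓ≢ with ∈-clause₁⁻ ℓ∈
      ... | q , refl , _ , eq with colour-ab eq
      ...   | inj₁ refl = refl
      ...   | inj₂ refl = ⊥-elim (ℓ≢ refl)

  known-ab : ∀ {Γ c w} → adj G c w ≡ true → Base Γ → Known Γ (neg (a c w , a c w)) →
             Derivation Γ (λ Γ′ → Known Γ′ (pos (a c w , b c w))) 1
  known-ab cw base k =
    known-by-clause k (base (clause₁∈F (a∈vertices cw))) (∈-clause₁⁺ (a∈vertices cw) refl) (∈-clause₁⁺ (b∈vertices cw) refl)
      (λ ()) only-ab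
    where
      only-ab : ∀ {c w ℓ} → ℓ ∈ clause₁ (a c w) → ℓ ≢ pos (a c w , a c w) → ℓ ≡ pos (a c w , b c w)
      only-ab ℓ∈ ℓ≢ with ∈-clause₁⁻ ℓ∈
      ... | q , refl , _ , eq with colour-ab eq
      ...   | inj₁ refl = ⊥-elim (ℓ≢ refl)
      ...   | inj₂ refl = refl

  NeighbourFact : Context → Fin n → Fin n → Set
  NeighbourFact Γ c w = Known Γ (pos (a c w , a c w)) ⊎ Assumption (neg (a c w , a c w))

  NeighbourFacts : Context → Fin n → Fin n → Set
  NeighbourFacts Γ c z = ∀ w → adj G c w ≡ true → w ≢ z → NeighbourFact Γ c w

  neighbourFacts-mono : ∀ {Γ Γ′ c z} → Γ ⊆ Γ′ → NeighbourFacts Γ c z → NeighbourFacts Γ′ c z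
  neighbourFacts-mono Γ⊆ facts w cw w≢z with facts w cw w≢z
  ... | inj₁ k = inj₁ (known-mono Γ⊆ k)
  ... | inj₂ as = inj₂ as

  -- a^c_w is adjacent to m^c_S (w ∈ S) but not to m^c_∅ (w ∉ ∅).
  a-separates-middles : ∀ c w S → adj G c w ≡ true → lookup S w ≡ true →
                        type3Condition E₁ E₂ (a c w) (m c ∅ᵇ) (a c w) (m c S) ≡ true
  a-separates-middles c w S cw Sw rewrite ≡⇒compatible {a c w} {a c w} refl | ≡⇒compatible {m c ∅ᵇ} {m c S} refl
                                        | ==-refl c | cw | lookup-replicate w false | Sw = refl

  -- m^c_∅ is adjacent to b^c_z but not to a^c_z.
  middle-separates-ab : ∀ c z → adj G c z ≡ true → type3Condition E₁ E₂ (m c ∅ᵇ) (a c z) (m c ∅ᵇ) (b c z) ≡ true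
  middle-separates-ab c z cz rewrite ≡⇒compatible {m c ∅ᵇ} {m c ∅ᵇ} refl | ≡⇒compatible {a c z} {b c z} refl
                                   | ==-refl c | cz | lookup-replicate z false = refl

  -- An even S ≠ ∅ contains some w ≠ z, and x_{a^c_w, a^c_w} rules out x_{m^c_∅, m^c_S}.
  middle-excluded : ∀ {Γ} c z S → Base Γ → NeighbourFacts Γ c z → S ∈ evenSubsets c → S ≢ ∅ᵇ →
                    Derivation Γ (λ Γ′ → Known Γ′ (neg (m c ∅ᵇ , m c S))) 1
  middle-excluded c z S base facts S∈ S≢∅ with ∈-evenSubsets⁻ {c} S∈
  ... | S⊆ , even with even-nonempty-other S z even S≢∅
  ...   | w , Sw , w≢z with ∈-nbrs⇒adj {c} S⊆ Sw
  ...     | cw with facts w cw w≢z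
  ...       | inj₁ k = known-by-binary k (base K∈F) (λ ())
    where K∈F = clause₃∈F (a∈vertices cw) (m∅∈vertices c) (a∈vertices cw) (m∈vertices S⊆ even) (a-separates-middles c w S cw Sw)
  ...       | inj₂ as = relax z≤n (return (_ , base K∈F , there (here refl) , K-lits))
    where
      K∈F = clause₃∈F (a∈vertices cw) (m∅∈vertices c) (a∈vertices cw) (m∈vertices S⊆ even) (a-separates-middles c w S cw Sw)
      K-lits : ∀ {ℓ} → ℓ ∈ (neg (a c w , a c w) ∷ neg (m c ∅ᵇ , m c S) ∷ []) → ℓ ≡ neg (m c ∅ᵇ , m c S) ⊎ Assumption ℓ
      K-lits (here refl) = inj₂ as
      K-lits (there (here refl)) = inj₁ refl

  MiddleInvariant : Fin n → Clause Var → List (Vec Bool n) → Set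
  MiddleInvariant c R pending = pos (m c ∅ᵇ , m c ∅ᵇ) ∈ R ×
    (∀ {ℓ} → ℓ ∈ R → (∃ λ S → ℓ ≡ pos (m c ∅ᵇ , m c S) × (S ∈ pending ⊎ S ≡ ∅ᵇ)) ⊎ Assumption ℓ)

  -- Starting from the type-1 clause of m^c_∅, resolve away every x_{m^c_∅, m^c_S} with S ≠ ∅.
  middle-fixed : ∀ c z (pending : List (Vec Bool n)) → (∀ {S} → S ∈ pending → S ∈ evenSubsets c) →
                 ∀ {Γ} (R : Clause Var) → Base Γ → NeighbourFacts Γ c z → R ∈ Γ → MiddleInvariant c R pending →
                 Derivation Γ (λ Γ′ → Known Γ′ (pos (m c ∅ᵇ , m c ∅ᵇ))) (2 * length pending)
  middle-fixed c z [] _ R base facts R∈ (m∅∈R , lits) = return (R , R∈ , m∅∈R , R-lits)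
    where
      R-lits : ∀ {ℓ} → ℓ ∈ R → ℓ ≡ pos (m c ∅ᵇ , m c ∅ᵇ) ⊎ Assumption ℓ
      R-lits ℓ∈ with lits ℓ∈
      ... | inj₁ (_ , refl , inj₂ refl) = inj₁ refl
      ... | inj₂ as = inj₂ as
  middle-fixed c z (S ∷ pending) pending⊆ {Γ} R base facts R∈ (m∅∈R , lits) with Vec.≡-dec _≟ᵇ_ S ∅ᵇ
  ... | yes refl = relax (*-monoʳ-≤ 2 (n≤1+n (length pending)))
                     (middle-fixed c z pending (λ S∈ → pending⊆ (there S∈)) R base facts R∈ (m∅∈R , lits′))
    where
      lits′ : ∀ {ℓ} → ℓ ∈ R → _
      lits′ ℓ∈ with lits ℓ∈
      ... | inj₁ (S′ , eq , inj₁ (here refl)) = inj₁ (S′ , eq , inj₂ refl)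
      ... | inj₁ (S′ , eq , inj₁ (there S′∈)) = inj₁ (S′ , eq , inj₁ S′∈)
      ... | inj₁ (S′ , eq , inj₂ S′≡) = inj₁ (S′ , eq , inj₂ S′≡)
      ... | inj₂ as = inj₂ as
  ... | no S≢∅ with pos (m c ∅ᵇ , m c S) ∈ˡ? R
  ...   | no S∉R = relax (*-monoʳ-≤ 2 (n≤1+n (length pending)))
                     (middle-fixed c z pending (λ S∈ → pending⊆ (there S∈)) R base facts R∈ (m∅∈R , lits′))
    where
      lits′ : ∀ {ℓ} → ℓ ∈ R → _
      lits′ ℓ∈ with lits ℓ∈
      ... | inj₁ (S′ , refl , inj₁ (here refl)) = ⊥-elim (S∉R ℓ∈)
      ... | inj₁ (S′ , eq , inj₁ (there S′∈)) = inj₁ (S′ , eq , inj₁ S′∈)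
      ... | inj₁ (S′ , eq , inj₂ S′≡) = inj₁ (S′ , eq , inj₂ S′≡)
      ... | inj₂ as = inj₂ as
  ...   | yes S∈R = relax (≤-reflexive (sym (*-distribˡ-+ 2 1 (length pending))))
                      (middle-excluded c z S base facts (pending⊆ (here refl)) S≢∅ >>= continue)
    where
      continue : ∀ Γ₁ → Γ ⊆ Γ₁ → Known Γ₁ (neg (m c ∅ᵇ , m c S)) →
                 Derivation Γ₁ (λ Γ′ → Known Γ′ (pos (m c ∅ᵇ , m c ∅ᵇ))) (1 + 2 * length pending)
      continue Γ₁ Γ⊆Γ₁ (X , X∈ , S̄∈X , X-lits) =
        resolveStep (Γ⊆Γ₁ R∈) X∈ S∈R S̄∈X >>= λ Γ₂ Γ₁⊆Γ₂ R′∈ →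
        middle-fixed c z pending (λ S∈ → pending⊆ (there S∈)) (resolve R X (m c ∅ᵇ , m c S))
          (λ C∈ → Γ₁⊆Γ₂ (Γ⊆Γ₁ (base C∈))) (neighbourFacts-mono (λ C∈ → Γ₁⊆Γ₂ (Γ⊆Γ₁ C∈)) facts) R′∈
          (∈-resolve⁺ {R} {X} {m c ∅ᵇ , m c S} (inj₁ (m∅∈R , λ eq → S≢∅ (sym (m-injective eq)))) , lits′)
        where
          m-injective : ∀ {S S′} → pos {Var} (m c ∅ᵇ , m c S) ≡ pos (m c ∅ᵇ , m c S′) → S ≡ S′
          m-injective refl = refl
          lits′ : ∀ {ℓ} → ℓ ∈ resolve R X (m c ∅ᵇ , m c S) → _
          lits′ ℓ∈ with ∈-resolve⁻ {R} {X} {m c ∅ᵇ , m c S} ℓ∈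
          ... | inj₁ (ℓ∈R , ℓ≢) with lits ℓ∈R
          ...   | inj₁ (S′ , refl , inj₁ (here refl)) = ⊥-elim (ℓ≢ refl)
          ...   | inj₁ (S′ , eq , inj₁ (there S′∈)) = inj₁ (S′ , eq , inj₁ S′∈)
          ...   | inj₁ (S′ , eq , inj₂ S′≡) = inj₁ (S′ , eq , inj₂ S′≡)
          ...   | inj₂ as = inj₂ as
          lits′ ℓ∈ | inj₂ (ℓ∈X , ℓ≢) with X-lits ℓ∈X
          ...   | inj₁ ℓ≡ = ⊥-elim (ℓ≢ ℓ≡)
          ...   | inj₂ as = inj₂ as

  gadget-step : ∀ {Γ} c z → adj G c z ≡ true → Base Γ → NeighbourFacts Γ c z →
                Derivation Γ (λ Γ′ → Known Γ′ (neg (a c z , b c z))) (2 * length (evenSubsets c) + 1)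
  gadget-step c z cz base facts =
    middle-fixed c z (evenSubsets c) (λ S∈ → S∈) (clause₁ (m c ∅ᵇ)) base facts (base (clause₁∈F (m∅∈vertices c)))
                 (∈-clause₁⁺ (m∅∈vertices c) refl , R-lits)
      >>= λ Γ₁ Γ⊆Γ₁ k → known-by-binary k (Γ⊆Γ₁ (base K∈F)) (λ ())
    where
      K∈F = clause₃∈F (m∅∈vertices c) (a∈vertices cz) (m∅∈vertices c) (b∈vertices cz) (middle-separates-ab c z cz)
      R-lits : ∀ {ℓ} → ℓ ∈ clause₁ (m c ∅ᵇ) → _
      R-lits ℓ∈ with ∈-clause₁⁻ ℓ∈
      ... | q , refl , q∈ , eq with colour-m eq
      ...   | S , refl with ∈-vertices⁻ q∈
      ...     | S⊆ , even = inj₁ (S , refl , inj₁ (∈-evenSubsets⁺ S⊆ even))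

  adj-sym : ∀ {x y} → adj G x y ≡ true → adj G y x ≡ true
  adj-sym {x} {y} = trans (SimpleGraph.sym G y x)

  adj⇒≢ : ∀ {x y} → adj G x y ≡ true → x ≢ y
  adj⇒≢ {x} xy refl = ≢-true-false xy (SimpleGraph.irrefl G x) refl

  depth-u₀ : depth u₀ ≡ 0
  depth-u₀ = n≤0⇒n≡0 (depth-minimal 0 (==-refl u₀) z≤n)

  parent-u₀ : parent u₀ ≡ u₀
  parent-u₀ = cong (λ k → parentVia k u₀) depth-u₀

  u₀∈ : InComponent u₀
  u₀∈ = reach-mono {0} {n} u₀ z≤n (==-refl u₀)

  private
    n≥1 : 1 ≤ n
    n≥1 = fin-pos u₀
      where
        fin-pos : ∀ {k} → Fin k → 1 ≤ k
        fin-pos zero = s≤s z≤n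
        fin-pos (suc _) = s≤s z≤n

    reach₁-v₀ : reach 1 v₀ ≡ true
    reach₁-v₀ = reach-step {0} (adj-sym u₀v₀) (==-refl u₀)

  v₀∈ : InComponent v₀
  v₀∈ = reach-mono v₀ n≥1 reach₁-v₀

  depth-v₀ : depth v₀ ≡ 1
  depth-v₀ with depth v₀ in eq | depth-minimal {v₀} 1 reach₁-v₀ n≥1
  ... | zero | _ = ⊥-elim (adj⇒≢ u₀v₀ (sym (depth≡0⇒root v₀∈ eq)))
  ... | suc zero | _ = refl
  ... | suc (suc _) | s≤s ()

  parent-v₀ : parent v₀ ≡ u₀
  parent-v₀ = ==⇒≡ (parent v₀) u₀ (proj₂ (parent-adj v₀∈ depth-v₀))

  depth-child : ∀ {c w} → InComponent w → parent w ≡ c → adj G c w ≡ true → depth w ≡ suc (depth c)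
  depth-child {c} {w} w∈ pw cw = by-depth (depth w) refl
    where
      by-depth : ∀ k → depth w ≡ k → depth w ≡ suc (depth c)
      by-depth zero eq = ⊥-elim (adj⇒≢ cw (sym (trans (sym (cong (λ k → parentVia k w) eq)) pw)))
      by-depth (suc j) eq = trans eq (cong suc (trans (sym (depth-parent w∈ eq)) (cong depth pw)))

  twisted : Fin n → Fin n → Bool
  twisted u w = ((u == u₀) ∧ (w == v₀)) ∨ ((u == v₀) ∧ (w == u₀))

  untwisted : ∀ {c p} → c ≢ u₀ → c ≢ v₀ → twisted c p ≡ false
  untwisted c≢u₀ c≢v₀ rewrite ≢⇒==false c≢u₀ | ≢⇒==false c≢v₀ = refl

  -- {u₀ , v₀} is a tree edge, so no non-tree edge is twisted.
  nonTree-untwisted : ∀ {x y} → NonTreeEdge x y → twisted x y ≡ false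
  nonTree-untwisted {x} {y} e with x == u₀ in xu | y == v₀ in yv
  ... | true | true = ⊥-elim (parent-y≢x (trans (cong parent (==⇒≡ y v₀ yv)) (trans parent-v₀ (sym (==⇒≡ x u₀ xu)))))
    where open NonTreeEdge e
  ... | true | false = reversed
    where
      open NonTreeEdge e
      reversed : ((x == v₀) ∧ (y == u₀)) ≡ false
      reversed with x == v₀ in xv | y == u₀ in yu
      ... | false | _ = refl
      ... | true | false = refl
      ... | true | true = ⊥-elim (parent-x≢y (trans (cong parent (==⇒≡ x v₀ xv)) (trans parent-v₀ (sym (==⇒≡ y u₀ yu)))))
  ... | false | _ = reversed
    where
      open NonTreeEdge e
      reversed : ((x == v₀) ∧ (y == u₀)) ≡ false
      reversed with x == v₀ in xv | y == u₀ in yu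
      ... | false | _ = refl
      ... | true | false = refl
      ... | true | true = ⊥-elim (parent-x≢y (trans (cong parent (==⇒≡ x v₀ xv)) (trans parent-v₀ (sym (==⇒≡ y u₀ yu)))))

  untwisted-connection : ∀ c p → adj G c p ≡ true → twisted c p ≡ false →
                         type3Condition E₁ E₂ (a c p) (a p c) (a c p) (b p c) ≡ true
  untwisted-connection c p cp tw rewrite ≡⇒compatible {a c p} {a c p} refl | ≡⇒compatible {a p c} {b p c} refl
                                       | ==-refl c | ==-refl p | cp | tw = refl

  twisted-connection : type3Condition E₁ E₂ (a v₀ u₀) (a u₀ v₀) (a v₀ u₀) (a u₀ v₀) ≡ true
  twisted-connection rewrite ≡⇒compatible {a v₀ u₀} {a v₀ u₀} refl | ≡⇒compatible {a u₀ v₀} {a u₀ v₀} refl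
                           | ≢⇒==false (λ (v₀≡u₀ : v₀ ≡ u₀) → adj⇒≢ u₀v₀ (sym v₀≡u₀)) | ==-refl u₀ | ==-refl v₀ | adj-sym u₀v₀ = refl

  -- What the climb establishes at a non-root vertex c.
  ParentFact : Context → Fin n → Set
  ParentFact Γ c = (c ≡ v₀ → Known Γ (pos (a u₀ v₀ , b u₀ v₀))) × (c ≢ v₀ → Known Γ (pos (a (parent c) c , a (parent c) c)))

  parentFact-mono : ∀ {Γ Γ′ c} → Γ ⊆ Γ′ → ParentFact Γ c → ParentFact Γ′ c
  parentFact-mono Γ⊆ (at-v₀ , elsewhere) = (λ eq → known-mono Γ⊆ (at-v₀ eq)) , (λ ne → known-mono Γ⊆ (elsewhere ne))

  DeeperFacts : Context → ℕ → Set
  DeeperFacts Γ j = ∀ w → InComponent w → j < depth w → ParentFact Γ w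

  deeperFacts-mono : ∀ {Γ Γ′ j} → Γ ⊆ Γ′ → DeeperFacts Γ j → DeeperFacts Γ′ j
  deeperFacts-mono Γ⊆ facts w w∈ j< = parentFact-mono Γ⊆ (facts w w∈ j<)

  NonTreeFacts : Context → Set
  NonTreeFacts Γ = ∀ y x → NonTreeEdge y x → toℕ x < toℕ y → Known Γ (pos (a y x , a y x))

  nonTreeFacts-mono : ∀ {Γ Γ′} → Γ ⊆ Γ′ → NonTreeFacts Γ → NonTreeFacts Γ′
  nonTreeFacts-mono Γ⊆ facts y x e x<y = known-mono Γ⊆ (facts y x e x<y)

  -- Every neighbour w ≠ z of c is a child (handled by a deeper layer) or a non-tree neighbour
  -- (an assumption if c < w, proved in advance if w < c).
  neighbourFacts : ∀ {Γ} c z → InComponent c → (∀ w → adj G c w ≡ true → w ≢ z → parent c ≢ w) →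
                   (∀ w → w ≢ z → parent w ≡ c → w ≢ v₀) → DeeperFacts Γ (depth c) → NonTreeFacts Γ → NeighbourFacts Γ c z
  neighbourFacts c z c∈ parent-c≢ child≢v₀ deeper nonTree w cw w≢z with parent w ≟ᶠ c
  ... | yes pw = inj₁ (subst (λ p → Known _ (pos (a p w , a p w))) pw
                   (proj₂ (deeper w (inComponent-adj c∈ cw) (≤-reflexive (sym (depth-child (inComponent-adj c∈ cw) pw cw))))
                     (child≢v₀ w w≢z pw)))
  ... | no pw≢ with <-cmp c w
  ...   | tri< c<w _ _ = inj₂ (c , w , e , c<w , refl)
    where e = record { adjacent = cw ; x∈ = c∈ ; y∈ = inComponent-adj c∈ cw ; parent-x≢y = parent-c≢ w cw w≢z ; parent-y≢x = pw≢ }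
  ...   | tri≈ _ c≡w _ = ⊥-elim (adj⇒≢ cw c≡w)
  ...   | tri> _ _ w<c = inj₁ (nonTree c w e w<c)
    where e = record { adjacent = cw ; x∈ = c∈ ; y∈ = inComponent-adj c∈ cw ; parent-x≢y = parent-c≢ w cw w≢z ; parent-y≢x = pw≢ }

  climb : ∀ {Γ} c k → InComponent c → depth c ≡ suc k → Base Γ → DeeperFacts Γ (depth c) → NonTreeFacts Γ →
          Derivation Γ (λ Γ′ → ParentFact Γ′ c) (2 * length (evenSubsets c) + 4)
  climb {Γ} c k c∈ eq base deeper nonTree =
    relax (≤-reflexive (+-assoc (2 * length (evenSubsets c)) 1 3))
      (gadget-step c (parent c) cp base facts >>= λ Γ₁ Γ⊆Γ₁ k₁ →
       known-aa cp (λ C∈ → Γ⊆Γ₁ (base C∈)) k₁ >>= λ Γ₂ Γ₁⊆Γ₂ k₂ →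
       cross Γ₂ (λ C∈ → Γ₁⊆Γ₂ (Γ⊆Γ₁ (base C∈))) k₂)
    where
      cp = proj₁ (parent-adj c∈ eq)
      c≢u₀ : c ≢ u₀
      c≢u₀ c≡u₀ = 1+n≢0 (trans (sym eq) (trans (cong depth c≡u₀) depth-u₀))
      facts = neighbourFacts c (parent c) c∈ (λ w _ w≢p p≡w → w≢p (sym p≡w))
                (λ { w _ pw refl → c≢u₀ (trans (sym pw) parent-v₀) }) deeper nonTree
      -- across the connecting edge into the parent's gadget
      cross : ∀ Γ₂ → Base Γ₂ → Known Γ₂ (pos (a c (parent c) , a c (parent c))) → Derivation Γ₂ (λ Γ′ → ParentFact Γ′ c) 2
      cross Γ₂ base₂ k₂ with c ≟ᶠ v₀
      ... | yes refl =
        known-by-binary (subst (λ p → Known Γ₂ (pos (a v₀ p , a v₀ p))) parent-v₀ k₂)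
          (base₂ (clause₃∈F (a∈vertices (adj-sym u₀v₀)) (a∈vertices u₀v₀) (a∈vertices (adj-sym u₀v₀)) (a∈vertices u₀v₀) twisted-connection))
          (λ { refl → adj⇒≢ u₀v₀ refl })
        >>= λ Γ₃ Γ₂⊆Γ₃ k₃ →
        post-map (λ _ _ k₄ → (λ _ → k₄) , (λ ne → ⊥-elim (ne refl))) (known-ab u₀v₀ (λ C∈ → Γ₂⊆Γ₃ (base₂ C∈)) k₃)
      ... | no c≢v₀ =
        known-by-binary k₂
          (base₂ (clause₃∈F (a∈vertices cp) (a∈vertices (adj-sym cp)) (a∈vertices cp) (b∈vertices (adj-sym cp))
                   (untwisted-connection c (parent c) cp (untwisted {p = parent c} c≢u₀ c≢v₀)))) (λ ())
        >>= λ Γ₃ Γ₂⊆Γ₃ k₃ →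
        post-map (λ _ _ k₄ → (λ c≡v₀ → ⊥-elim (c≢v₀ c≡v₀)) , (λ _ → k₄)) (known-aa (adj-sym cp) (λ C∈ → Γ₂⊆Γ₃ (base₂ C∈)) k₃)

  OnlyAssumptions : Context → Set
  OnlyAssumptions Γ = ∃ λ E → E ∈ Γ × (∀ {ℓ} → ℓ ∈ E → Assumption ℓ)

  at-root : ∀ {Γ} → Base Γ → DeeperFacts Γ 0 → NonTreeFacts Γ → Derivation Γ OnlyAssumptions (2 * length (evenSubsets u₀) + 1 + 1)
  at-root {Γ} base deeper nonTree with proj₁ (deeper v₀ v₀∈ (subst (0 <_) (sym depth-v₀) (s≤s z≤n))) refl
  ... | X , X∈ , ab∈X , X-lits =
    gadget-step u₀ v₀ u₀v₀ base facts >>= λ Γ₁ Γ⊆Γ₁ (Y , Y∈ , ab̄∈Y , Y-lits) →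
    post-map (λ _ _ R∈ → _ , R∈ , R-lits Y-lits) (resolveStep (Γ⊆Γ₁ X∈) Y∈ ab∈X ab̄∈Y)
    where
      facts = neighbourFacts u₀ v₀ u₀∈ (λ w uw _ p≡w → adj⇒≢ uw (trans (sym parent-u₀) p≡w)) (λ w w≢v₀ _ → w≢v₀)
                (subst (DeeperFacts Γ) (sym depth-u₀) deeper) nonTree
      R-lits : ∀ {Y} → (∀ {ℓ} → ℓ ∈ Y → ℓ ≡ neg (a u₀ v₀ , b u₀ v₀) ⊎ Assumption ℓ) →
               ∀ {ℓ} → ℓ ∈ resolve X Y (a u₀ v₀ , b u₀ v₀) → Assumption ℓ
      R-lits {Y} Y-lits ℓ∈ with ∈-resolve⁻ {X} {Y} {a u₀ v₀ , b u₀ v₀} ℓ∈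
      ... | inj₁ (ℓ∈X , ℓ≢) with X-lits ℓ∈X
      ...   | inj₁ ℓ≡ = ⊥-elim (ℓ≢ ℓ≡)
      ...   | inj₂ as = as
      R-lits {Y} Y-lits ℓ∈ | inj₂ (ℓ∈Y , ℓ≢) with Y-lits ℓ∈Y
      ...   | inj₁ ℓ≡ = ⊥-elim (ℓ≢ ℓ≡)
      ...   | inj₂ as = as

  vertexPairs : List (Fin n × Fin n)
  vertexPairs = concatMap (λ y → map (y ,_) (allFinList n)) (allFinList n)

  ∈-vertexPairs : ∀ y x → (y , x) ∈ vertexPairs
  ∈-vertexPairs y x = ∈-concatMap⁺′ (∈-allFin y) (∈-map⁺ (y ,_) (∈-allFin x))

  nonTreeCost : Fin n × Fin n → ℕ
  nonTreeCost (y , x) = indicator (nonTree y x)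

  NonTreeFact : Fin n × Fin n → Context → Set
  NonTreeFact (y , x) Γ = NonTreeEdge y x → toℕ x < toℕ y → Known Γ (pos (a y x , a y x))

  -- The type-3 clause ¬x_{a^x_y, a^x_y} ∨ ¬x_{a^y_x, b^y_x} already says ¬x_{a^y_x, b^y_x} modulo an assumption.
  nonTreeFact : ∀ Γ p → Base Γ → Derivation Γ (NonTreeFact p) (nonTreeCost p)
  nonTreeFact Γ (y , x) base with nonTree y x in yx
  ... | false = return (λ e → ⊥-elim (≢-true-false (NonTreeEdge⇒nonTree e) yx refl))
  ... | true with toℕ x <? toℕ y
  ...   | no x≮y = relax z≤n (return (λ _ x<y → ⊥-elim (x≮y x<y)))
  ...   | yes x<y = post-map (λ _ _ k _ _ → k) (known-aa (adj-sym xy) base (_ , K∈ , there (here refl) , K-lits))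
    where
      e : NonTreeEdge x y
      e = NonTreeEdge-sym (nonTree⇒NonTreeEdge yx)
      xy = NonTreeEdge.adjacent e
      K∈ = base (clause₃∈F (a∈vertices xy) (a∈vertices (adj-sym xy)) (a∈vertices xy) (b∈vertices (adj-sym xy))
                   (untwisted-connection x y xy (nonTree-untwisted e)))
      K-lits : ∀ {ℓ} → ℓ ∈ (neg (a x y , a x y) ∷ neg (a y x , b y x) ∷ []) → ℓ ≡ neg (a y x , b y x) ⊎ Assumption ℓ
      K-lits (here refl) = inj₂ (x , y , e , x<y , refl)
      K-lits (there (here refl)) = inj₁ refl

  nonTreeFacts : ∀ {Γ} → Base Γ → Derivation Γ (λ Γ′ → Base Γ′ × NonTreeFacts Γ′) (sum (map nonTreeCost vertexPairs))
  nonTreeFacts base =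
    post-map (λ _ _ (base′ , facts) → base′ , λ y x → facts (∈-vertexPairs y x))
      (forEach vertexPairs nonTreeCost Base NonTreeFact (λ Γ⊆ base′ C∈ → Γ⊆ (base′ C∈)) (λ {p} → mono p)
               (λ Γ p _ base′ → nonTreeFact Γ p base′) base)
    where
      mono : ∀ p {Γ Γ′} → Γ ⊆ Γ′ → NonTreeFact p Γ → NonTreeFact p Γ′
      mono (y , x) Γ⊆ fact e x<y = known-mono Γ⊆ (fact e x<y)

  climbCost : Fin n → ℕ
  climbCost c = 2 * length (evenSubsets c) + 4

  layerCost : ℕ → Fin n → ℕ
  layerCost k c = if (depth c ≡ᵇ k) ∧ reach n c then climbCost c else 0

  LayerInvariant : ℕ → Context → Set
  LayerInvariant k Γ = Base Γ × DeeperFacts Γ k × NonTreeFacts Γ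

  LayerGoal : ℕ → Fin n → Context → Set
  LayerGoal k c Γ = InComponent c → depth c ≡ k → ParentFact Γ c

  layer-vertex : ∀ j Γ c → LayerInvariant (suc j) Γ → Derivation Γ (LayerGoal (suc j) c) (layerCost (suc j) c)
  layer-vertex j Γ c (base , deeper , nonTree) with depth c ≡ᵇ suc j in d≡ᵇ | reach n c in r∈
  ... | false | _ = return (λ _ d≡ → ⊥-elim (≢-true-false (T⇒≡true (≡⇒≡ᵇ (depth c) (suc j) d≡)) d≡ᵇ refl))
  ... | true | false = return (λ ())
  ... | true | true =
    let d≡ = ≡ᵇ⇒≡ (depth c) (suc j) (≡true⇒T d≡ᵇ) in
    post-map (λ _ _ fact _ _ → fact) (climb c j r∈ d≡ base (subst (DeeperFacts Γ) (sym d≡) deeper) nonTree)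

  layer : ∀ j {Γ} → LayerInvariant (suc j) Γ → Derivation Γ (LayerInvariant j) (sum (map (layerCost (suc j)) (allFinList n)))
  layer j inv =
    post-map (λ _ _ → next)
      (forEach (allFinList n) (layerCost (suc j)) (LayerInvariant (suc j)) (LayerGoal (suc j))
        (λ Γ⊆ (base , deeper , nonTree) → (λ C∈ → Γ⊆ (base C∈)) , deeperFacts-mono Γ⊆ deeper , nonTreeFacts-mono Γ⊆ nonTree)
        (λ Γ⊆ goal c∈ d≡ → parentFact-mono Γ⊆ (goal c∈ d≡)) (λ Γ c _ → layer-vertex j Γ c) inv)
    where
      next : ∀ {Γ} → LayerInvariant (suc j) Γ × (∀ {c} → c ∈ allFinList n → LayerGoal (suc j) c Γ) → LayerInvariant j Γ
      next ((base , deeper , nonTree) , goals) = base , facts , nonTree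
        where
          facts : DeeperFacts _ j
          facts w w∈ j< with m≤n⇒m<n∨m≡n j<
          ... | inj₁ sj< = deeper w w∈ sj<
          ... | inj₂ sj≡ = goals (∈-allFin w) w∈ (sym sj≡)

  layersCost : ℕ → ℕ
  layersCost zero = 0
  layersCost (suc j) = sum (map (layerCost (suc j)) (allFinList n)) + layersCost j

  layers : ∀ j {Γ} → LayerInvariant j Γ → Derivation Γ (LayerInvariant 0) (layersCost j)
  layers zero inv = return inv
  layers (suc j) inv = layer j inv >>= λ _ _ inv′ → layers j inv′

  dischargeCost : Fin n × Fin n → ℕ
  dischargeCost (x , y) = 3 * indicator (nonTree x y)

  AssumptionsAmong : Clause Var → List (Fin n × Fin n) → Set
  AssumptionsAmong E pending = ∀ {ℓ} → ℓ ∈ E →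
    ∃ λ x → ∃ λ y → NonTreeEdge x y × toℕ x < toℕ y × ℓ ≡ neg (a x y , a x y) × (x , y) ∈ pending

  skip : ∀ {x y pending E} → (NonTreeEdge x y → toℕ x < toℕ y → neg (a x y , a x y) ∈ E → ⊥) →
         AssumptionsAmong E ((x , y) ∷ pending) → AssumptionsAmong E pending
  skip absent among ℓ∈ with among ℓ∈
  ... | x′ , y′ , e′ , x′<y′ , refl , here refl = ⊥-elim (absent e′ x′<y′ ℓ∈)
  ... | x′ , y′ , e′ , x′<y′ , eq , there p∈ = x′ , y′ , e′ , x′<y′ , eq , p∈

  module CycleSymmetry {x y : Fin n} (e : NonTreeEdge x y) where
    open FundamentalCycle e public
    open Flip cycleSubgraph public

    opaque
      unfolding F
      cycle-mapsInto : MapsInto (flip-renaming u₀ v₀) F F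
      cycle-mapsInto = flip-mapsInto u₀ v₀

  -- Resolving E with the type-1 clause of a^x_y and then with its image under the cycle symmetry
  -- removes ¬x_{a^x_y, a^x_y}; the symmetry fixes every other assumption literal.
  discharge : ∀ pending {Γ} E → Base Γ → E ∈ Γ → AssumptionsAmong E pending →
              Derivation Γ (⊥ᶜ ∈_) (sum (map dischargeCost pending))
  discharge [] {Γ} E base E∈ among = return (subst (_∈ Γ) (no-member⇒[] E λ ℓ∈ → no-pending (among ℓ∈)) E∈)
    where
      no-pending : ∀ {ℓ} → ∃ (λ x → ∃ λ y → NonTreeEdge x y × toℕ x < toℕ y × ℓ ≡ neg (a x y , a x y) × (x , y) ∈ []) → ⊥
      no-pending (_ , _ , _ , _ , _ , ())
  discharge ((x , y) ∷ pending) {Γ} E base E∈ among with nonTree x y in xy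
  ... | false = discharge pending E base E∈ (skip (λ e _ _ → ≢-true-false (NonTreeEdge⇒nonTree e) xy refl) among)
  ... | true with toℕ x <? toℕ y
  ...   | no x≮y = relax (m≤n+m _ 3) (discharge pending E base E∈ (skip (λ _ x<y _ → x≮y x<y) among))
  ...   | yes x<y with neg (a x y , a x y) ∈ˡ? E
  ...     | no ∉E = relax (m≤n+m _ 3) (discharge pending E base E∈ (skip (λ _ _ ∈E → ∉E ∈E) among))
  ...     | yes ∈E =
    derive (global-sym σE cycle-mapsInto E∈ ((λ ℓ∈ → ℓ∈) , (λ ℓ∈ → ℓ∈))) >>= λ Γ₁ Γ⊆Γ₁ E′∈ →
    resolveStep (Γ⊆Γ₁ (base (clause₁∈F (a∈vertices adjacent)))) (Γ⊆Γ₁ E∈) (∈-clause₁⁺ (a∈vertices adjacent) refl) ∈E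
      >>= λ Γ₂ Γ₁⊆Γ₂ R₁∈ →
    resolveStep R₁∈ (Γ₁⊆Γ₂ E′∈) ab∈R₁ ab̄∈E′ >>= λ Γ₃ Γ₂⊆Γ₃ R₂∈ →
    discharge pending R₂ (λ C∈ → Γ₂⊆Γ₃ (Γ₁⊆Γ₂ (Γ⊆Γ₁ (base C∈)))) R₂∈ among′
    where
      e : NonTreeEdge x y
      e = nonTree⇒NonTreeEdge xy
      open NonTreeEdge e using (adjacent)
      open CycleSymmetry e
      σE = flip-renaming u₀ v₀
      E′ = rename σE E
      R₁ = resolve (clause₁ (a x y)) E (a x y , a x y)
      R₂ = resolve R₁ E′ (a x y , b x y)
      flip-axy : flip (a x y) ≡ b x y
      flip-axy = cong (λ t → if t then b x y else a x y) cycle-own-edge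
      ab∈R₁ : pos (a x y , b x y) ∈ R₁
      ab∈R₁ = ∈-resolve⁺ {clause₁ (a x y)} {E} {a x y , a x y} (inj₁ (∈-clause₁⁺ (b∈vertices adjacent) refl , λ ()))
      ab̄∈E′ : neg (a x y , b x y) ∈ E′
      ab̄∈E′ = subst (λ q → neg (a x y , q) ∈ E′) flip-axy (∈-map⁺ (Renaming.σ σE) ∈E)
      fixed : ∀ {x′ y′} → NonTreeEdge x′ y′ → toℕ x′ < toℕ y′ → (x′ , y′) ∈ ((x , y) ∷ pending) → (x′ ≡ x → y′ ≡ y → ⊥) →
              ∃ λ x″ → ∃ λ y″ → NonTreeEdge x″ y″ × toℕ x″ < toℕ y″ ×
                neg (a x′ y′ , flip (a x′ y′)) ≡ neg (a x″ y″ , a x″ y″) × (x″ , y″) ∈ pending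
      fixed e′ x′<y′ (here refl) ≢xy = ⊥-elim (≢xy refl refl)
      fixed {x′} {y′} e′ x′<y′ (there p∈) ≢xy =
        x′ , y′ , e′ , x′<y′ , cong (λ t → neg (a x′ y′ , (if t then b x′ y′ else a x′ y′))) (cycle-other-edge e′ x<y x′<y′ ≢xy) , p∈
      among′ : AssumptionsAmong R₂ pending
      among′ ℓ∈ with ∈-resolve⁻ {R₁} {E′} {a x y , b x y} ℓ∈
      ... | inj₁ (ℓ∈R₁ , ℓ≢ab) with ∈-resolve⁻ {clause₁ (a x y)} {E} {a x y , a x y} ℓ∈R₁
      ...   | inj₁ (ℓ∈K , ℓ≢aa) with ∈-clause₁⁻ ℓ∈K
      ...     | q , refl , _ , eq with colour-ab eq
      ...       | inj₁ refl = ⊥-elim (ℓ≢aa refl)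
      ...       | inj₂ refl = ⊥-elim (ℓ≢ab refl)
      among′ ℓ∈ | inj₁ (ℓ∈R₁ , ℓ≢ab) | inj₂ (ℓ∈E , ℓ≢aā) with among ℓ∈E
      ...   | x′ , y′ , e′ , x′<y′ , refl , here refl = ⊥-elim (ℓ≢aā refl)
      ...   | x′ , y′ , e′ , x′<y′ , eq , there p∈ = x′ , y′ , e′ , x′<y′ , eq , p∈
      among′ ℓ∈ | inj₂ (ℓ∈E′ , ℓ≢ab̄) with ∈-map⁻ (Renaming.σ σE) ℓ∈E′
      ... | ℓ₀ , ℓ₀∈E , refl with among ℓ₀∈E
      ...   | x′ , y′ , e′ , x′<y′ , refl , p∈ with x′ ≟ᶠ x | y′ ≟ᶠ y
      ...     | yes refl | yes refl = ⊥-elim (ℓ≢ab̄ (cong (λ q → neg (a x y , q)) flip-axy))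
      ...     | yes refl | no y′≢y = fixed e′ x′<y′ p∈ (λ _ eq → y′≢y eq)
      ...     | no x′≢x | _ = fixed e′ x′<y′ p∈ (λ eq _ → x′≢x eq)

  deeper-than-n : ∀ {Γ} → DeeperFacts Γ n
  deeper-than-n w _ n< = ⊥-elim (<-irrefl refl (<-≤-trans n< (depth≤n w)))

  totalCost : ℕ
  totalCost = sum (map nonTreeCost vertexPairs) + (layersCost n + ((2 * length (evenSubsets u₀) + 1 + 1) + sum (map dischargeCost vertexPairs)))

  derivation-of-⊥ : Derivation F (⊥ᶜ ∈_) totalCost
  derivation-of-⊥ =
    nonTreeFacts {F} (λ C∈ → C∈) >>= λ _ _ (base , nonTree) →
    layers n (base , deeper-than-n , nonTree) >>= λ _ _ (base₁ , deeper , nonTree₁) →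
    at-root base₁ deeper nonTree₁ >>= λ _ Γ⊆ (E , E∈ , E-lits) →
    discharge vertexPairs E (λ C∈ → Γ⊆ (base₁ C∈)) E∈ (λ ℓ∈ → pending (E-lits ℓ∈))
    where
      pending : ∀ {ℓ} → Assumption ℓ → _
      pending (x , y , e , x<y , eq) = x , y , e , x<y , eq , ∈-vertexPairs x y

  opaque
    unfolding F clause₁

    ⊥ᶜ∉F : ¬ (⊥ᶜ ∈ F)
    ⊥ᶜ∉F ⊥∈ = nonempty (Iso.isoClause vertices vertices E₁ E₂ ⊥∈) refl
      where
        nonempty : ∀ {C} → Iso.IsoClause vertices vertices E₁ E₂ C → C ≢ ⊥ᶜ
        nonempty (Iso.type1-clause {v} v∈) eq with () ← subst (pos (v , v) ∈_) eq (∈-clause₁⁺ v∈ refl)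
        nonempty (Iso.type2-clause _ _ _ _) ()
        nonempty (Iso.type3-clause _ _ _ _ _) ()

    size≡ : length (deduplicate (_≋?_ _≟V_) F) ≡ size u₀ v₀
    size≡ = refl

  ≋-setoid : Setoid 0ℓ 0ℓ
  ≋-setoid = record
    { Carrier = Clause Var ; _≈_ = _≋_
    ; isEquivalence = record
      { refl = (λ ℓ∈ → ℓ∈) , (λ ℓ∈ → ℓ∈)
      ; sym = λ (C⊆D , D⊆C) → D⊆C , C⊆D
      ; trans = λ (C⊆D , D⊆C) (D⊆E , E⊆D) → (λ ℓ∈ → D⊆E (C⊆D ℓ∈)) , (λ ℓ∈ → D⊆C (E⊆D ℓ∈)) } }

  open Setoid ≋-setoid using () renaming (refl to ≋-refl; sym to ≋-sym; trans to ≋-trans)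

  clause₁-injective : ∀ {p q} → p ∈ vertices → clause₁ p ≋ clause₁ q → p ≡ q
  clause₁-injective p∈ (p⊆q , _) with ∈-clause₁⁻ (p⊆q (∈-clause₁⁺ p∈ refl))
  ... | _ , refl , _ = refl

  -- The type-1 clauses of distinct vertices are distinct, so |F| ≥ |V(X(G))|.
  vertices≤size : length vertices ≤ size u₀ v₀
  vertices≤size = subst (_≤ size u₀ v₀) (length-map clause₁ vertices) (subst (length (map clause₁ vertices) ≤_) size≡
    (pigeonhole _≋_ ≋-sym ≋-trans (map clause₁ vertices) (deduplicate (_≋?_ _≟V_) F)
      (AllPairs.map⁺ (distinct unique-vertices (λ p∈ _ p≢q eq → p≢q (clause₁-injective p∈ eq))))
      covered))
    where
      distinct : {R S : XV n → XV n → Set} {xs : List (XV n)} → AllPairs R xs →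
                 (∀ {x y} → x ∈ xs → y ∈ xs → R x y → S x y) → AllPairs S xs
      distinct [] _ = []
      distinct (Rx ∷ Rxs) R⇒S =
        All.tabulate (λ y∈ → R⇒S (here refl) (there y∈) (All.lookup Rx y∈))
          ∷ distinct Rxs (λ x∈ y∈ → R⇒S (there x∈) (there y∈))
      covered : ∀ {C} → C ∈ map clause₁ vertices → Any (C ≋_) (deduplicate (_≋?_ _≟V_) F)
      covered C∈ with ∈-map⁻ clause₁ C∈
      ... | p , p∈ , refl = SetoidMembership.∈-deduplicate⁺ ≋-setoid (_≋?_ _≟V_) (λ z≋y x≋y → ≋-trans x≋y (≋-sym z≋y))
                              (Any.map (λ { refl → ≋-refl }) (clause₁∈F p∈))

  evenSubsets-nonempty : ∀ c → 1 ≤ length (evenSubsets c)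
  evenSubsets-nonempty c = nonempty (∈-evenSubsets⁺ {c} (∅ᵇ∈subsets c) (∅ᵇ-even {n}))
    where
      nonempty : ∀ {xs : List (Vec Bool n)} → ∅ᵇ ∈ xs → 1 ≤ length xs
      nonempty (here _) = s≤s z≤n
      nonempty (there _) = s≤s z≤n

  private
    A₀ B₀ : ℕ
    A₀ = sum (map degree (allFinList n))
    B₀ = sum (map (λ c → length (evenSubsets c)) (allFinList n))

    nonTree≤adj : ∀ y x → indicator (nonTree y x) ≤ indicator (adj G y x)
    nonTree≤adj y x with adj G y x
    ... | true = indicator≤1 _
    ... | false = z≤n

    sum-vertexPairs : ∀ (f : Fin n × Fin n → ℕ) →
                      sum (map f vertexPairs) ≡ sum (map (λ y → sum (map (λ x → f (y , x)) (allFinList n))) (allFinList n))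
    sum-vertexPairs f = trans (sum-map-concatMap f (λ y → map (y ,_) (allFinList n)) (allFinList n))
                              (sum-map-cong (allFinList n) (λ y → sum-map-map f (y ,_) (allFinList n)))

    nonTreeCost≤ : sum (map nonTreeCost vertexPairs) ≤ A₀
    nonTreeCost≤ = ≤-trans (≤-reflexive (sum-vertexPairs nonTreeCost))
                     (sum-map-mono (allFinList n) (λ y → sum-map-mono (allFinList n) (nonTree≤adj y)))

    dischargeCost≤ : sum (map dischargeCost vertexPairs) ≤ 3 * A₀
    dischargeCost≤ = begin
      sum (map dischargeCost vertexPairs)
        ≡⟨ sum-vertexPairs dischargeCost ⟩
      sum (map (λ y → sum (map (λ x → 3 * indicator (nonTree y x)) (allFinList n))) (allFinList n))
        ≡⟨ sum-map-cong (allFinList n) (λ y → sum-map-* 3 (λ x → indicator (nonTree y x)) (allFinList n)) ⟩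
      sum (map (λ y → 3 * sum (map (λ x → indicator (nonTree y x)) (allFinList n))) (allFinList n))
        ≡⟨ sum-map-* 3 (λ y → sum (map (λ x → indicator (nonTree y x)) (allFinList n))) (allFinList n) ⟩
      3 * sum (map (λ y → sum (map (λ x → indicator (nonTree y x)) (allFinList n))) (allFinList n))
        ≤⟨ *-monoʳ-≤ 3 (sum-map-mono (allFinList n) (λ y → sum-map-mono (allFinList n) (nonTree≤adj y))) ⟩
      3 * A₀ ∎
      where open ≤-Reasoning

    rootCost≤ : 2 * length (evenSubsets u₀) + 1 + 1 ≤ 4 * B₀
    rootCost≤ = ≤-trans (≤-trans (≤-reflexive (+-assoc (2 * ev) 1 1))
                                  (≤-trans (+-monoʳ-≤ (2 * ev) (*-monoʳ-≤ 2 (evenSubsets-nonempty u₀)))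
                                           (≤-reflexive (sym (*-distribʳ-+ ev 2 2)))))
                        (*-monoʳ-≤ 4 (∈⇒≤sum-map (λ c → length (evenSubsets c)) (∈-allFin u₀)))
      where ev = length (evenSubsets u₀)

    climbsUpTo : ℕ → Fin n → ℕ
    climbsUpTo j c = if depth c ≤ᵇ j then climbCost c else 0

    layer-accumulates : ∀ j c → layerCost (suc j) c + climbsUpTo j c ≤ climbsUpTo (suc j) c
    layer-accumulates j c with depth c ≡ᵇ suc j in d≡ | depth c ≤ᵇ j in d≤j | depth c ≤ᵇ suc j in d≤sj
    ... | true | true | _ =
      ⊥-elim (<-irrefl refl (≤-trans (≤-reflexive (sym (≡ᵇ⇒≡ (depth c) (suc j) (≡true⇒T d≡)))) (≤ᵇ⇒≤ (depth c) j (≡true⇒T d≤j))))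
    ... | true | false | true with reach n c
    ...   | true = ≤-reflexive (+-identityʳ (climbCost c))
    ...   | false = z≤n
    layer-accumulates j c | true | false | false =
      ⊥-elim (≢-true-false (T⇒≡true (≤⇒≤ᵇ (≤-reflexive (≡ᵇ⇒≡ (depth c) (suc j) (≡true⇒T d≡))))) d≤sj refl)
    layer-accumulates j c | false | true | true = ≤-refl
    layer-accumulates j c | false | true | false =
      ⊥-elim (≢-true-false (T⇒≡true (≤⇒≤ᵇ (m≤n⇒m≤1+n (≤ᵇ⇒≤ (depth c) j (≡true⇒T d≤j))))) d≤sj refl)
    layer-accumulates j c | false | false | _ = z≤n

    layersCost≤climbs : ∀ j → layersCost j ≤ sum (map (climbsUpTo j) (allFinList n))
    layersCost≤climbs zero = z≤n
    layersCost≤climbs (suc j) =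
      ≤-trans (+-monoʳ-≤ (sum (map (layerCost (suc j)) (allFinList n))) (layersCost≤climbs j))
        (≤-trans (≤-reflexive (sym (sum-map-+ (layerCost (suc j)) (climbsUpTo j) (allFinList n))))
                 (sum-map-mono (allFinList n) (layer-accumulates j)))

    climbsUpTo≤ : ∀ j c → climbsUpTo j c ≤ 6 * length (evenSubsets c)
    climbsUpTo≤ j c with depth c ≤ᵇ j
    ... | false = z≤n
    ... | true = ≤-trans (+-monoʳ-≤ (2 * length (evenSubsets c)) (*-monoʳ-≤ 4 (evenSubsets-nonempty c)))
                         (≤-reflexive (sym (*-distribʳ-+ (length (evenSubsets c)) 2 4)))

    layersCost≤ : layersCost n ≤ 6 * B₀
    layersCost≤ = ≤-trans (layersCost≤climbs n)
                    (≤-trans (sum-map-mono (allFinList n) (climbsUpTo≤ n))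
                             (≤-reflexive (sum-map-* 6 (λ c → length (evenSubsets c)) (allFinList n))))

    totalCost-bound : ∀ A B → A + (6 * B + (4 * B + 3 * A)) + 16 * A ≡ 10 * (2 * A + B)
    totalCost-bound = solve-∀

  totalCost≤ : totalCost ≤ 10 * length vertices
  totalCost≤ =
    ≤-trans (+-mono-≤ nonTreeCost≤ (+-mono-≤ layersCost≤ (+-mono-≤ rootCost≤ dischargeCost≤)))
      (≤-trans (m≤m+n _ (16 * A₀)) (≤-reflexive (trans (totalCost-bound A₀ B₀) (cong (10 *_) (sym length-vertices)))))

  refutation-from : ∀ {b} → Derivation F (⊥ᶜ ∈_) b → b ≤ 10 * size u₀ v₀ →
                    ∃ λ cs → SRC-I-Refutation (F-CFI u₀ v₀) cs × length cs ≤ 10 * size u₀ v₀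
  refutation-from (derivation cs steps length≤ ⊥∈) b≤ with ∈-++⁻ F ⊥∈
  ... | inj₁ ⊥∈F = ⊥-elim (⊥ᶜ∉F ⊥∈F)
  ... | inj₂ ⊥∈cs = cs , subst (λ F′ → SRC-I-Refutation F′ cs) F≡F-CFI (steps , ⊥∈cs) , ≤-trans length≤ b≤

  refutation : ∃ λ cs → SRC-I-Refutation (F-CFI u₀ v₀) cs × length cs ≤ 10 * size u₀ v₀
  refutation = refutation-from derivation-of-⊥ (≤-trans totalCost≤ (*-monoʳ-≤ 10 vertices≤size))

theorem3p1 : ∃ λ (C : ℕ) → ∀ (n : ℕ) (G : SimpleGraph n) (u₀ v₀ : Fin n) →
    adj G u₀ v₀ ≡ true →
    Σ (List (Clause (XV n × XV n))) λ cs →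
      SRC-I-Refutation (CFI.F-CFI G u₀ v₀) cs × length cs ≤ C * CFI.size G u₀ v₀
theorem3p1 = 10 , λ n G u₀ v₀ u₀v₀ → Refutation.refutation G u₀ v₀ u₀v₀
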